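{- Let $R$ be an order and $X$ a (possibly infinite) set of non-zero ideals of $R$. Then $\overline{X}\subseteq\mathcal{I}(R)$ if and only if $X$ has a coprime basis. If $X$ has a coprime basis, then $\{I\in\overline{X} : \#\{J\in\overline{X} : I\subseteq J\}=2\}$ is the minimal coprime basis of $X$.
   Context: An order is a domain whose additive group is isomorphic to $\mathbb{Z}^n$ for some $n>0$; $\mathrm{Q}(R)$ is its field of fractions. For $R$-submodules $I,J$ of $\mathrm{Q}(R)$, $I:J=\{x\in\mathrm{Q}(R): xJ\subseteq I\}$. An invertible ideal of $R$ is an $R$-submodule $I$ of $\mathrm{Q}(R)$ such that $IJ=R$ for some $R$-submodule $J$ of $\mathrm{Q}(R)$; $\mathcal{I}(R)$ denotes the group of invertible ideals. $\overline{X}$ is the closure of $X\cup\{R\}$ under addition, multiplication and integral division, the latter meaning forming $I:J$ for ideals $I,J\subseteq R$ with $J$ invertible and $I:J\subseteq R$. A coprime basis of $X$ is a set $B$ of invertible ideals strictly contained in $R$ which are pairwise coprime ($\mathfrak{a}+\mathfrak{b}=R$) and such that $X$ is contained in the subgroup $\langle B\rangle$ of $\mathcal{I}(R)$ generated by $B$. Coprime bases are partially ordered by $B\leq C$ iff $\langle B\rangle\subseteq\langle C\rangle$; the minimal one is the least element. -}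

module Defs where

open import Level using (0ℓ) renaming (suc to lsuc)
open import Algebra.Bundles using (CommutativeRing)
open import Data.Nat using (ℕ) renaming (_<_ to _<ℕ_)
open import Data.Integer using (ℤ) renaming (_+_ to _+ℤ_)
open import Data.Vec using (Vec; zipWith)
open import Data.Product using (Σ; ∃; _×_; _,_)
open import Data.Sum using (_⊎_; inj₁; inj₂)
open import Relation.Nullary using (¬_)
open import Relation.Binary.PropositionalEquality using (_≡_)

record IsOrder (R : CommutativeRing 0ℓ 0ℓ) : Set where
  open CommutativeRing R
  field
    1≉0       : ¬ (1# ≈ 0#)
    noZeroDiv : ∀ x y → x * y ≈ 0# → x ≈ 0# ⊎ y ≈ 0#
    rank      : ℕ
    rank>0    : 0 <ℕ rank
    toVec     : Carrier → Vec ℤ rank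
    fromVec   : Vec ℤ rank → Carrier
    toVec-cong : ∀ {x y} → x ≈ y → toVec x ≡ toVec y
    toVec-+   : ∀ x y → toVec (x + y) ≡ zipWith _+ℤ_ (toVec x) (toVec y)
    from-to   : ∀ x → fromVec (toVec x) ≈ x
    to-from   : ∀ v → toVec (fromVec v) ≡ v

module OrderTheory (R : CommutativeRing 0ℓ 0ℓ) (O : IsOrder R) where
  open CommutativeRing R
  open IsOrder O

  private
    prod≉0 : ∀ {b d} → ¬ (b ≈ 0#) → ¬ (d ≈ 0#) → ¬ (b * d ≈ 0#)
    prod≉0 {b} {d} b≉0 d≉0 bd≈0 with noZeroDiv b d bd≈0
    ... | inj₁ p = b≉0 p
    ... | inj₂ p = d≉0 p

  -- Q(R): the field of fractions, as fractions num/den (den ≠ 0) up to ≃.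
  record Frac : Set where
    constructor _/_∶_
    field
      num : Carrier
      den : Carrier
      den≉0 : ¬ (den ≈ 0#)
  open Frac

  _≃_ : Frac → Frac → Set
  p ≃ q = num p * den q ≈ num q * den p

  _+F_ : Frac → Frac → Frac
  p +F q = ((num p * den q) + (num q * den p)) / (den p * den q) ∶ prod≉0 (den≉0 p) (den≉0 q)

  _*F_ : Frac → Frac → Frac
  p *F q = (num p * num q) / (den p * den q) ∶ prod≉0 (den≉0 p) (den≉0 q)

  ι : Carrier → Frac
  ι r = r / 1# ∶ 1≉0

  0F : Frac
  0F = ι 0#

  Sub : Set₁
  Sub = Frac → Set

  _⊆_ : Sub → Sub → Set
  I ⊆ J = ∀ x → I x → J x

  _≅_ : Sub → Sub → Set
  I ≅ J = (I ⊆ J) × (J ⊆ I)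

  record IsSubmodule (I : Sub) : Set where
    field
      sm-resp : ∀ x y → x ≃ y → I x → I y
      sm-zero : I 0F
      sm-add  : ∀ x y → I x → I y → I (x +F y)
      sm-smul : ∀ r x → I x → I (ι r *F x)

  Rᵖ : Sub
  Rᵖ x = ∃ λ r → x ≃ ι r

  _⊕_ : Sub → Sub → Sub
  (I ⊕ J) x = ∃ λ a → ∃ λ b → I a × J b × x ≃ (a +F b)

  data _⊗_ (I J : Sub) : Frac → Set where
    pz : ∀ {x} → x ≃ 0F → (I ⊗ J) x
    ps : ∀ {x y a b} → (I ⊗ J) y → I a → J b → x ≃ (y +F (a *F b)) → (I ⊗ J) x

  _∶∶_ : Sub → Sub → Sub
  (I ∶∶ J) x = ∀ y → J y → I (x *F y)

  -- invertible (fractional) ideals: elements of 𝓘(R)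
  Invertible : Sub → Set₁
  Invertible I = IsSubmodule I × Σ Sub (λ J → IsSubmodule J × ((I ⊗ J) ≅ Rᵖ))

  IsIdeal : Sub → Set
  IsIdeal I = IsSubmodule I × (I ⊆ Rᵖ)

  NonZero : Sub → Set
  NonZero I = ∃ λ x → I x × ¬ (x ≃ 0F)

  SubSet : Set₂
  SubSet = Sub → Set₁

  -- X̄ : closure of X ∪ {R} under +, ·, integral division (up to equality of sets)
  data Closure (X : SubSet) : Sub → Set₁ where
    base : ∀ {I} → X I → Closure X I
    one  : Closure X Rᵖ
    add  : ∀ {I J} → Closure X I → Closure X J → Closure X (I ⊕ J)
    mul  : ∀ {I J} → Closure X I → Closure X J → Closure X (I ⊗ J)
    div  : ∀ {I J} → Closure X I → Closure X J → Invertible J → (I ∶∶ J) ⊆ Rᵖ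
         → Closure X (I ∶∶ J)
    resp : ∀ {I J} → Closure X I → I ≅ J → Closure X J

  -- ⟨B⟩: subgroup of 𝓘(R) generated by B (inverse of invertible J is R : J)
  data Gen (B : SubSet) : Sub → Set₁ where
    gone : ∀ {I} → I ≅ Rᵖ → Gen B I
    gpos : ∀ {I K J} → Gen B K → B J → I ≅ (K ⊗ J) → Gen B I
    gneg : ∀ {I K J} → Gen B K → B J → I ≅ (K ⊗ (Rᵖ ∶∶ J)) → Gen B I

  IsCoprimeBasis : SubSet → SubSet → Set₁
  IsCoprimeBasis X B =
      (∀ J → B J → Invertible J × (J ⊆ Rᵖ) × ¬ (Rᵖ ⊆ J))
    × (∀ a b → B a → B b → ¬ (a ≅ b) → (a ⊕ b) ≅ Rᵖ)
    × (∀ I → X I → Gen B I)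

  HasCoprimeBasis : SubSet → Set₂
  HasCoprimeBasis X = Σ SubSet (IsCoprimeBasis X)

  _≤B_ : SubSet → SubSet → Set₁
  B ≤B C = ∀ I → Gen B I → Gen C I

  IsMinimalCoprimeBasis : SubSet → SubSet → Set₂
  IsMinimalCoprimeBasis X B = IsCoprimeBasis X B × (∀ C → IsCoprimeBasis X C → B ≤B C)

  -- { I ∈ X̄ : #{ J ∈ X̄ : I ⊆ J } = 2 }   (elements counted up to equality of sets)
  TwoAbove : SubSet → SubSet
  TwoAbove X I = Closure X I ×
    Σ Sub (λ J₁ → Σ Sub (λ J₂ →
        Closure X J₁ × Closure X J₂ × I ⊆ J₁ × I ⊆ J₂ × ¬ (J₁ ≅ J₂)
      × (∀ J → Closure X J → I ⊆ J → (J ≅ J₁) ⊎ (J ≅ J₂))))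

{-# OPTIONS --safe #-}
-- An order is a free ℤ-module of finite rank, so its ideals satisfy the ascending chain condition
-- (their images in ℤⁿ do), and every element of X̄ is an ideal of R.
-- If X̄ ⊆ 𝓘(R), let T = {I ∈ X̄ : #{J ∈ X̄ : I ⊆ J} = 2}. An element I ≠ R of X̄ outside T lies strictly
-- below some J ∈ X̄ with J ≠ R; then I = (I : J) J, where I : J ∈ X̄ also strictly contains I, so by
-- Noetherian induction every element of X̄ is a product of elements of T. Distinct a, b ∈ T are coprime,
-- because a + b ∈ X̄ contains both. Conversely, over a coprime basis B an inclusion of products of
-- elements of B is a divisibility, so every integral ideal in ⟨B⟩ is such a product, and a sum of two
-- products is again one (common factors come out, coprime ones disappear). Hence these products
-- contain X and R and are closed under sums, products and integral quotients, whence X̄ ⊆ ⟨B⟩ ⊆ 𝓘(R).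
-- Finally T ⊆ X̄ ⊆ ⟨B⟩ is the minimality of T.
module Submission where

open import Level using (0ℓ; _⊔_; Lift; lift; lower) renaming (suc to lsuc)
open import Algebra.Bundles using (CommutativeRing; CommutativeSemiring; Group; AbelianGroup)
open import Algebra.Definitions using (Congruent₂; Associative; Commutative; LeftIdentity; LeftZero; _DistributesOverʳ_)
open import Algebra.Structures.Biased using (isCommutativeSemiringˡ; isCommutativeMonoidˡ)
open import Axiom.ExcludedMiddle using (ExcludedMiddle)
open import Data.Empty using (⊥-elim)
open import Data.List using (List; []; _∷_; _++_)
open import Data.List.Relation.Unary.All using (All; []; _∷_)
open import Data.List.Relation.Unary.All.Properties using (++⁺; ─⁺; ¬Any⇒All¬)
open import Data.List.Relation.Unary.Any using (Any; here; there; _─_; any?)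
open import Data.Product using (Σ; ∃; _×_; _,_; proj₁; proj₂)
open import Data.Sum using (_⊎_; inj₁; inj₂; [_,_]′)
open import Function using (id)
open import Function.Bundles using (_⇔_; mk⇔)
open import Induction.WellFounded using (WellFounded; Acc; acc)
open import Relation.Binary using (Rel; _Respectsʳ_; IsEquivalence; Preorder)
open import Relation.Nullary using (¬_; yes; no)
import Relation.Nullary.Decidable as Dec
import Relation.Binary.Reasoning.Preorder as PreorderReasoning
import Relation.Binary.Reasoning.Setoid as SetoidReasoning
open import Relation.Unary.Properties using (⊆′-refl; ⊆′-trans; ≐′-refl; ≐′-sym; ≐′-trans)
open import Defs

lower-em : ∀ {ℓ ℓ′} → ExcludedMiddle (ℓ ⊔ ℓ′) → ExcludedMiddle ℓ
lower-em {ℓ′ = ℓ′} em = Dec.map′ lower lift (em {Lift ℓ′ _})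

module Lattices where

  open import Axiom.DoubleNegationElimination using (em⇒dne)
  open import Data.Integer using (ℤ; +_; +[1+_]; -[1+_]; 0ℤ; _+_; _*_; -_)
  import Data.Integer.Properties as ℤ
  open import Data.Integer.DivMod using (_%ℕ_; _/ℕ_; n%ℕd<d; a≡a%ℕn+[a/ℕn]*n)
  open import Data.Nat as ℕ using (ℕ; zero; suc)
  open import Data.Nat.Induction using (<-wellFounded)
  open import Data.Product.Relation.Binary.Lex.Strict using (×-Lex; ×-wellFounded')
  open import Data.Vec using (Vec; []; _∷_; zipWith; map; replicate)
  open import Data.Vec.Properties
    using (zipWith-assoc; zipWith-identityˡ; zipWith-identityʳ; zipWith-inverseˡ; zipWith-inverseʳ)
  open import Relation.Binary.PropositionalEquality as ≡ using (_≡_; refl; cong; cong₂; subst)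
  open import Relation.Unary using (Pred; _∈_; _∉_; _⊆_; _⊈_; _⊂_; _≐_)
  open import Relation.Unary.Properties using (≐-trans; ⊂-respˡ-≐)

  ⊈-witness : ExcludedMiddle 0ℓ → ∀ {A : Set} {P Q : Pred A 0ℓ} → P ⊈ Q → ∃ λ x → x ∈ P × x ∉ Q
  ⊈-witness em P⊈Q = em⇒dne em λ ∄ → P⊈Q λ {x} x∈P → em⇒dne em λ x∉Q → ∄ (x , x∈P , x∉Q)

  record IsSubgroup (G : Group 0ℓ 0ℓ) (A : Pred (Group.Carrier G) 0ℓ) : Set where
    open Group G
    field
      ε∈        : ε ∈ A
      ∙-closed  : ∀ {x y} → x ∈ A → y ∈ A → x ∙ y ∈ A
      ⁻¹-closed : ∀ {x} → x ∈ A → x ⁻¹ ∈ A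

  open IsSubgroup

  Supergroup : (G : Group 0ℓ 0ℓ) → Rel (Pred (Group.Carrier G) 0ℓ) 0ℓ
  Supergroup G B A = IsSubgroup G B × A ⊂ B

  syntax Supergroup G B A = B ⊐[ G ] A

  Noetherian : Group 0ℓ 0ℓ → Set₁
  Noetherian G = WellFounded (Supergroup G)

  module _ (G : Group 0ℓ 0ℓ) where

    noetherian-from-subgroups : (∀ {A} → IsSubgroup G A → Acc (Supergroup G) A) → Noetherian G
    noetherian-from-subgroups acc-subgroup A = acc λ (sB , _) → acc-subgroup sB

    ⊐-respʳ-≐ : Supergroup G Respectsʳ _≐_
    ⊐-respʳ-≐ A≐A′ (sB , A⊂B) = sB , ⊂-respˡ-≐ A≐A′ A⊂B

  ℤ-group : Group 0ℓ 0ℓ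
  ℤ-group = AbelianGroup.group ℤ.+-0-abelianGroup

  multiples-closed : ∀ {A} → IsSubgroup ℤ-group A → ∀ {m} → m ∈ A → ∀ q → q * m ∈ A
  multiples-closed {A} sA {m} m∈A = integers
    where
    naturals : ∀ n → + n * m ∈ A
    naturals zero = ε∈ sA
    naturals (suc n) = subst A (≡.sym (ℤ.*-distribʳ-+ m (+ 1) (+ n)))
      (∙-closed sA (subst A (≡.sym (ℤ.*-identityˡ m)) m∈A) (naturals n))
    integers : ∀ q → q * m ∈ A
    integers (+ n) = naturals n
    integers -[1+ n ] = subst A (ℤ.neg-distribˡ-* (+ suc n) m) (⁻¹-closed sA (naturals (suc n)))

  ℤⁿ-group : ℕ → Group 0ℓ 0ℓ
  ℤⁿ-group n = record
    { Carrier = Vec ℤ n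
    ; _≈_ = _≡_
    ; _∙_ = zipWith _+_
    ; ε = replicate n 0ℤ
    ; _⁻¹ = map -_
    ; isGroup = record
      { isMonoid = record
        { isSemigroup = record
          { isMagma = record { isEquivalence = ≡.isEquivalence ; ∙-cong = cong₂ (zipWith _+_) }
          ; assoc = zipWith-assoc ℤ.+-assoc
          }
        ; identity = zipWith-identityˡ ℤ.+-identityˡ , zipWith-identityʳ ℤ.+-identityʳ
        }
      ; inverse = zipWith-inverseˡ ℤ.+-inverseˡ , zipWith-inverseʳ ℤ.+-inverseʳ
      ; ⁻¹-cong = cong (map -_)
      }
    }

  module _ {n : ℕ} where

    headKernel : Pred (Vec ℤ (suc n)) 0ℓ → Pred (Vec ℤ n) 0ℓ
    headKernel A v = A (0ℤ ∷ v)

    headImage : Pred (Vec ℤ (suc n)) 0ℓ → Pred ℤ 0ℓ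
    headImage A z = ∃ λ v → A (z ∷ v)

    headKernel-subgroup : ∀ {A} → IsSubgroup (ℤⁿ-group (suc n)) A → IsSubgroup (ℤⁿ-group n) (headKernel A)
    headKernel-subgroup sA = record { ε∈ = ε∈ sA ; ∙-closed = ∙-closed sA ; ⁻¹-closed = ⁻¹-closed sA }

    headImage-subgroup : ∀ {A} → IsSubgroup (ℤⁿ-group (suc n)) A → IsSubgroup ℤ-group (headImage A)
    headImage-subgroup sA = record
      { ε∈ = _ , ε∈ sA
      ; ∙-closed = λ (_ , x∈A) (_ , y∈A) → _ , ∙-closed sA x∈A y∈A
      ; ⁻¹-closed = λ (_ , x∈A) → _ , ⁻¹-closed sA x∈A
      }

    ⊆-from-head : ∀ {A B} → IsSubgroup (ℤⁿ-group (suc n)) A → IsSubgroup (ℤⁿ-group (suc n)) B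
                → A ⊆ B → headKernel B ⊆ headKernel A → headImage B ⊆ headImage A → B ⊆ A
    ⊆-from-head {A} {B} sA sB A⊆B kerB⊆kerA imB⊆imA {z ∷ v} x∈B with imB⊆imA (v , x∈B)
    ... | u , y∈A = subst A x//y∙y≡x (∙-closed sA (kerB⊆kerA x//y∈B) y∈A)
      where
      open Group (ℤⁿ-group (suc n)) using (_∙_)
      open import Algebra.Properties.Group (ℤⁿ-group (suc n)) using (//-rightDividesˡ)
      t = zipWith _+_ v (map -_ u)
      x//y∈B : 0ℤ ∷ t ∈ B
      x//y∈B = subst (λ h → h ∷ t ∈ B) (ℤ.+-inverseʳ z) (∙-closed sB x∈B (⁻¹-closed sB (A⊆B y∈A)))
      x//y∙y≡x : (0ℤ ∷ t) ∙ (z ∷ u) ≡ z ∷ v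
      x//y∙y≡x = ≡.trans (cong (λ h → (h ∷ t) ∙ (z ∷ u)) (≡.sym (ℤ.+-inverseʳ z)))
                         (//-rightDividesˡ (z ∷ u) (z ∷ v))

    _<ₗₑₓ_ : Rel (Pred (Vec ℤ n) 0ℓ × Pred ℤ 0ℓ) 0ℓ
    _<ₗₑₓ_ = ×-Lex _≐_ (Supergroup (ℤⁿ-group n)) (Supergroup ℤ-group)

  module _ (em : ExcludedMiddle 0ℓ) where

    accessible-from-positive : ∀ {A} k → Acc ℕ._<_ k → IsSubgroup ℤ-group A → +[1+ k ] ∈ A
                             → Acc (Supergroup ℤ-group) A
    accessible-from-positive {A} k (acc smaller) sA m∈A =
      acc λ (sB , A⊆B , B⊈A) → reduce sB A⊆B (⊈-witness em B⊈A)
      where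
      open import Algebra.Properties.Group ℤ-group using (//-rightDividesʳ)
      m = suc k
      reduce : ∀ {B} → IsSubgroup ℤ-group B → A ⊆ B → ∃ (λ z → z ∈ B × z ∉ A)
             → Acc (Supergroup ℤ-group) B
      reduce {B} sB A⊆B (z , z∈B , z∉A) = from-remainder (z %ℕ m) refl (n%ℕd<d z m)
        where
        qm = (z /ℕ m) * + m
        qm∈A : qm ∈ A
        qm∈A = multiples-closed sA m∈A (z /ℕ m)
        z≡r+qm : z ≡ + (z %ℕ m) + qm
        z≡r+qm = a≡a%ℕn+[a/ℕn]*n z m
        r∈B : + (z %ℕ m) ∈ B
        r∈B = subst B (≡.trans (cong (_+ - qm) z≡r+qm) (//-rightDividesʳ qm _))
                      (∙-closed sB z∈B (⁻¹-closed sB (A⊆B qm∈A)))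
        from-remainder : ∀ r → z %ℕ m ≡ r → r ℕ.< m → Acc (Supergroup ℤ-group) B
        from-remainder zero r≡0 _ = ⊥-elim (z∉A (subst A qm≡z qm∈A))
          where
          qm≡z : qm ≡ z
          qm≡z = ≡.sym (≡.trans z≡r+qm (≡.trans (cong (λ r → + r + qm) r≡0) (ℤ.+-identityˡ qm)))
        from-remainder (suc r) r≡1+r r<m =
          accessible-from-positive r (smaller (ℕ.≤-pred r<m)) sB (subst (λ r → + r ∈ B) r≡1+r r∈B)

    ℤ-noetherian : Noetherian ℤ-group
    ℤ-noetherian = noetherian-from-subgroups ℤ-group λ sA →
      acc λ (sB , _ , B⊈A) → from-nonzero sA sB (⊈-witness em B⊈A)
      where
      from-nonzero : ∀ {A B} → IsSubgroup ℤ-group A → IsSubgroup ℤ-group B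
                   → ∃ (λ z → z ∈ B × z ∉ A) → Acc (Supergroup ℤ-group) B
      from-nonzero sA sB (+ zero , _ , 0∉A) = ⊥-elim (0∉A (ε∈ sA))
      from-nonzero sA sB (+[1+ k ] , z∈B , _) = accessible-from-positive k (<-wellFounded k) sB z∈B
      from-nonzero sA sB (-[1+ k ] , z∈B , _) =
        accessible-from-positive k (<-wellFounded k) sB (⁻¹-closed sB z∈B)

    ⊐⇒<ₗₑₓ : ∀ {n A B} → IsSubgroup (ℤⁿ-group (suc n)) A → B ⊐[ ℤⁿ-group (suc n) ] A
           → (headKernel B , headImage B) <ₗₑₓ (headKernel A , headImage A)
    ⊐⇒<ₗₑₓ {A = A} {B} sA (sB , A⊆B , B⊈A) with em {headKernel B ⊆ headKernel A}
    ... | no kerB⊈kerA = inj₁ (headKernel-subgroup sB , A⊆B , kerB⊈kerA)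
    ... | yes kerB⊆kerA = inj₂ ((kerB⊆kerA , A⊆B) , headImage-subgroup sB ,
          (λ (v , x∈A) → v , A⊆B x∈A) , λ imB⊆imA → B⊈A (⊆-from-head sA sB A⊆B kerB⊆kerA imB⊆imA))

    accessible-by-head : ∀ {n A} → IsSubgroup (ℤⁿ-group (suc n)) A
                       → Acc _<ₗₑₓ_ (headKernel A , headImage A) → Acc (Supergroup (ℤⁿ-group (suc n))) A
    accessible-by-head sA (acc smaller) =
      acc λ B⊐A@(sB , _) → accessible-by-head sB (smaller (⊐⇒<ₗₑₓ sA B⊐A))

    ℤⁿ-noetherian : ∀ n → Noetherian (ℤⁿ-group n)
    ℤⁿ-noetherian zero = noetherian-from-subgroups (ℤⁿ-group zero) λ sA →
      acc λ (_ , _ , B⊈A) → ⊥-elim (B⊈A λ { {[]} _ → ε∈ sA })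
    ℤⁿ-noetherian (suc n) = noetherian-from-subgroups (ℤⁿ-group (suc n)) λ sA →
      accessible-by-head sA (×-wellFounded' ≐-trans (⊐-respʳ-≐ (ℤⁿ-group n)) (ℤⁿ-noetherian n) ℤ-noetherian _)

open Lattices using (IsSubgroup; Supergroup; ℤⁿ-group; ℤⁿ-noetherian)

module Fractions (R : CommutativeRing 0ℓ 0ℓ) (O : IsOrder R) where

  open CommutativeRing R
  open IsOrder O using (noZeroDiv)
  open OrderTheory R O
  open Frac
  open import Algebra.Solver.Ring.NaturalCoefficients.Default commutativeSemiring
    using (solve; _:=_; _:+_; _:*_; con)
  open import Algebra.Properties.Ring ring using ([y-z]x≈yx-zx)
  open import Algebra.Properties.Group +-group using (x∙y⁻¹≈ε⇒x≈y)

  *-cancelʳ-≉0 : ∀ {x y d} → ¬ d ≈ 0# → x * d ≈ y * d → x ≈ y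
  *-cancelʳ-≉0 {x} {y} {d} d≉0 xd≈yd with noZeroDiv (x - y) d (begin
      (x - y) * d    ≈⟨ [y-z]x≈yx-zx d x y ⟩
      x * d - y * d  ≈⟨ +-congʳ xd≈yd ⟩
      y * d - y * d  ≈⟨ -‿inverseʳ (y * d) ⟩
      0#             ∎)
    where open SetoidReasoning setoid
  ... | inj₁ x-y≈0 = x∙y⁻¹≈ε⇒x≈y x y x-y≈0
  ... | inj₂ d≈0 = ⊥-elim (d≉0 d≈0)

  -- _≃_ unfolds to an equation in R, from which the fractions cannot be inferred.
  infix 4 _≋_
  record _≋_ (p q : Frac) : Set where
    constructor mk≋
    field ≋⇒≃ : p ≃ q
  open _≋_ public

  ≋-isEquivalence : IsEquivalence _≋_
  ≋-isEquivalence = record { refl = mk≋ refl ; sym = λ (mk≋ e) → mk≋ (sym e) ; trans = ≋-trans }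
    where
    open SetoidReasoning setoid
    ≋-trans : ∀ {p q r} → p ≋ q → q ≋ r → p ≋ r
    ≋-trans {a / b ∶ _} {c / d ∶ d≉0} {e / f ∶ _} (mk≋ ad≈cb) (mk≋ cf≈ed) = mk≋ (*-cancelʳ-≉0 d≉0 (begin
      a * f * d  ≈⟨ solve 3 (λ a f d → a :* f :* d := a :* d :* f) refl a f d ⟩
      a * d * f  ≈⟨ *-congʳ ad≈cb ⟩
      c * b * f  ≈⟨ solve 3 (λ c b f → c :* b :* f := c :* f :* b) refl c b f ⟩
      c * f * b  ≈⟨ *-congʳ cf≈ed ⟩
      e * d * b  ≈⟨ solve 3 (λ e d b → e :* d :* b := e :* b :* d) refl e d b ⟩
      e * b * d  ∎))

  +F-cong : Congruent₂ _≋_ _+F_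
  +F-cong {a / b ∶ _} {a′ / b′ ∶ _} {c / d ∶ _} {c′ / d′ ∶ _} (mk≋ ab′≈a′b) (mk≋ cd′≈c′d) =
    mk≋ (begin
    (a * d + c * b) * (b′ * d′)
      ≈⟨ solve 6 (λ a b c d b′ d′ → (a :* d :+ c :* b) :* (b′ :* d′)
                                  := a :* b′ :* (d :* d′) :+ c :* d′ :* (b :* b′)) refl a b c d b′ d′ ⟩
    a * b′ * (d * d′) + c * d′ * (b * b′)
      ≈⟨ +-cong (*-congʳ ab′≈a′b) (*-congʳ cd′≈c′d) ⟩
    a′ * b * (d * d′) + c′ * d * (b * b′)
      ≈⟨ solve 6 (λ a′ b c′ d b′ d′ → a′ :* b :* (d :* d′) :+ c′ :* d :* (b :* b′)
                                    := (a′ :* d′ :+ c′ :* b′) :* (b :* d)) refl a′ b c′ d b′ d′ ⟩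
    (a′ * d′ + c′ * b′) * (b * d) ∎)
    where open SetoidReasoning setoid

  *F-cong : Congruent₂ _≋_ _*F_
  *F-cong {a / b ∶ _} {a′ / b′ ∶ _} {c / d ∶ _} {c′ / d′ ∶ _} (mk≋ ab′≈a′b) (mk≋ cd′≈c′d) =
    mk≋ (begin
    a * c * (b′ * d′)
      ≈⟨ solve 4 (λ a c b′ d′ → a :* c :* (b′ :* d′) := a :* b′ :* (c :* d′)) refl a c b′ d′ ⟩
    a * b′ * (c * d′)
      ≈⟨ *-cong ab′≈a′b cd′≈c′d ⟩
    a′ * b * (c′ * d)
      ≈⟨ solve 4 (λ a′ b c′ d → a′ :* b :* (c′ :* d) := a′ :* c′ :* (b :* d)) refl a′ b c′ d ⟩
    a′ * c′ * (b * d) ∎)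
    where open SetoidReasoning setoid

  +F-assoc : Associative _≋_ _+F_
  +F-assoc (a / b ∶ _) (c / d ∶ _) (e / f ∶ _) = mk≋ (solve 6 (λ a b c d e f →
      ((a :* d :+ c :* b) :* f :+ e :* (b :* d)) :* (b :* (d :* f))
    := (a :* (d :* f) :+ (c :* f :+ e :* d) :* b) :* (b :* d :* f)) refl a b c d e f)

  +F-comm : Commutative _≋_ _+F_
  +F-comm (a / b ∶ _) (c / d ∶ _) = mk≋ (solve 4 (λ a b c d →
    (a :* d :+ c :* b) :* (d :* b) := (c :* b :+ a :* d) :* (b :* d)) refl a b c d)

  +F-identityˡ : LeftIdentity _≋_ 0F _+F_
  +F-identityˡ (a / b ∶ _) = mk≋ (solve 2 (λ a b →
    (con 0 :* b :+ a :* con 1) :* b := a :* (con 1 :* b)) refl a b)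

  *F-assoc : Associative _≋_ _*F_
  *F-assoc (a / b ∶ _) (c / d ∶ _) (e / f ∶ _) = mk≋ (solve 6 (λ a b c d e f →
    a :* c :* e :* (b :* (d :* f)) := a :* (c :* e) :* (b :* d :* f)) refl a b c d e f)

  *F-comm : Commutative _≋_ _*F_
  *F-comm (a / b ∶ _) (c / d ∶ _) = mk≋ (solve 4 (λ a b c d →
    a :* c :* (d :* b) := c :* a :* (b :* d)) refl a b c d)

  *F-identityˡ : LeftIdentity _≋_ (ι 1#) _*F_
  *F-identityˡ (a / b ∶ _) = mk≋ (solve 2 (λ a b → con 1 :* a :* b := a :* (con 1 :* b)) refl a b)

  *F-zeroˡ : LeftZero _≋_ 0F _*F_
  *F-zeroˡ (a / b ∶ _) = mk≋ (solve 2 (λ a b → con 0 :* a :* con 1 := con 0 :* (con 1 :* b)) refl a b)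

  *F-distribʳ-+F : _DistributesOverʳ_ _≋_ _*F_ _+F_
  *F-distribʳ-+F (e / f ∶ _) (a / b ∶ _) (c / d ∶ _) = mk≋ (solve 6 (λ a b c d e f →
      (a :* d :+ c :* b) :* e :* (b :* f :* (d :* f))
    := (a :* e :* (d :* f) :+ c :* e :* (b :* f)) :* (b :* d :* f)) refl a b c d e f)

  Frac-commutativeSemiring : CommutativeSemiring 0ℓ 0ℓ
  Frac-commutativeSemiring = record
    { Carrier = Frac
    ; _≈_ = _≋_
    ; _+_ = _+F_
    ; _*_ = _*F_
    ; 0# = 0F
    ; 1# = ι 1#
    ; isCommutativeSemiring = isCommutativeSemiringˡ record
      { +-isCommutativeMonoid = isCommutativeMonoidˡ record
        { isSemigroup = record
          { isMagma = record { isEquivalence = ≋-isEquivalence ; ∙-cong = +F-cong } ; assoc = +F-assoc }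
        ; identityˡ = +F-identityˡ
        ; comm = +F-comm
        }
      ; *-isCommutativeMonoid = isCommutativeMonoidˡ record
        { isSemigroup = record
          { isMagma = record { isEquivalence = ≋-isEquivalence ; ∙-cong = *F-cong } ; assoc = *F-assoc }
        ; identityˡ = *F-identityˡ
        ; comm = *F-comm
        }
      ; distribʳ = *F-distribʳ-+F
      ; zeroˡ = *F-zeroˡ
      }
    }

  open CommutativeSemiring Frac-commutativeSemiring public using ()
    renaming ( refl to ≋-refl; sym to ≋-sym; trans to ≋-trans; setoid to ≋-setoid
             ; +-identityʳ to +F-identityʳ; zeroʳ to *F-zeroʳ; distribˡ to *F-distribˡ-+F)

  -- A fraction cannot be inferred from a sum or product containing it (unification gets stuck on
  -- the proof field den≉0), so the unchanged operand is explicit.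
  +F-congˡ : ∀ p {q q′} → q ≋ q′ → (p +F q) ≋ (p +F q′)
  +F-congˡ p = +F-cong (≋-refl {p})

  *F-congˡ : ∀ p {q q′} → q ≋ q′ → (p *F q) ≋ (p *F q′)
  *F-congˡ p = *F-cong (≋-refl {p})

  *F-congʳ : ∀ {p p′} q → p ≋ p′ → (p *F q) ≋ (p′ *F q)
  *F-congʳ q p≋p′ = *F-cong p≋p′ (≋-refl {q})

  ι-cong : ∀ {r s} → r ≈ s → ι r ≋ ι s
  ι-cong r≈s = mk≋ (*-congʳ r≈s)

  ι-+ : ∀ r s → ι (r + s) ≋ ι r +F ι s
  ι-+ r s = mk≋ (solve 2 (λ r s →
    (r :+ s) :* (con 1 :* con 1) := (r :* con 1 :+ s :* con 1) :* con 1) refl r s)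

  ι-* : ∀ r s → ι (r * s) ≋ ι r *F ι s
  ι-* r s = mk≋ (solve 2 (λ r s → r :* s :* (con 1 :* con 1) := r :* s :* con 1) refl r s)

module Submodules (R : CommutativeRing 0ℓ 0ℓ) (O : IsOrder R) where

  open CommutativeRing R using (_+_; _*_; 1#)
  open OrderTheory R O
  open Fractions R O
  open IsSubmodule
  open import Algebra.Solver.Ring.NaturalCoefficients.Default Frac-commutativeSemiring
    using (solve; _:=_; _:+_; _:*_)

  -- Defs' _⊆_ and _≅_ are Relation.Unary's _⊆′_ and _≐′_.
  ⊆-refl : ∀ {I} → I ⊆ I
  ⊆-refl = ⊆′-refl

  ⊆-trans : ∀ {I J K} → I ⊆ J → J ⊆ K → I ⊆ K
  ⊆-trans = ⊆′-trans

  ≅-refl : ∀ {I} → I ≅ I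
  ≅-refl = ≐′-refl

  ≅-sym : ∀ {I J} → I ≅ J → J ≅ I
  ≅-sym = ≐′-sym

  ≅-trans : ∀ {I J K} → I ≅ J → J ≅ K → I ≅ K
  ≅-trans = ≐′-trans

  Sub-preorder : Preorder (lsuc 0ℓ) 0ℓ 0ℓ
  Sub-preorder = record
    { Carrier = Sub
    ; _≈_ = _≅_
    ; _≲_ = _⊆_
    ; isPreorder = record
      { isEquivalence = record { refl = ≅-refl ; sym = ≅-sym ; trans = ≅-trans }
      ; reflexive = proj₁
      ; trans = ⊆-trans
      }
    }

  module ⊆-Reasoning where
    open PreorderReasoning Sub-preorder public
    open import Relation.Binary.Reasoning.Syntax using (module ⊆-syntax)
    open ⊆-syntax _IsRelatedTo_ _IsRelatedTo_ ≲-go public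

  ∈-resp-≋ : ∀ {I x y} → IsSubmodule I → x ≋ y → I x → I y
  ∈-resp-≋ sI (mk≋ x≃y) = sm-resp sI _ _ x≃y

  ≅-submodule : ∀ {I J} → I ≅ J → IsSubmodule I → IsSubmodule J
  ≅-submodule (I⊆J , J⊆I) sI = record
    { sm-resp = λ x y x≃y Jx → I⊆J y (sm-resp sI x y x≃y (J⊆I x Jx))
    ; sm-zero = I⊆J _ (sm-zero sI)
    ; sm-add = λ x y Jx Jy → I⊆J _ (sm-add sI x y (J⊆I x Jx) (J⊆I y Jy))
    ; sm-smul = λ r x Jx → I⊆J _ (sm-smul sI r x (J⊆I x Jx))
    }

  ι∈Rᵖ : ∀ r → Rᵖ (ι r)
  ι∈Rᵖ r = r , ≋⇒≃ (≋-refl {ι r})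

  Rᵖ-submodule : IsSubmodule Rᵖ
  Rᵖ-submodule = record
    { sm-resp = λ { x y x≃y (r , x≃r) →
        r , ≋⇒≃ (≋-trans (≋-sym (mk≋ {x} {y} x≃y)) (mk≋ {x} {ι r} x≃r)) }
    ; sm-zero = ι∈Rᵖ _
    ; sm-add = λ { x y (r , x≃r) (s , y≃s) →
        r + s , ≋⇒≃ (≋-trans (+F-cong (mk≋ {x} {ι r} x≃r) (mk≋ {y} {ι s} y≃s)) (≋-sym (ι-+ r s))) }
    ; sm-smul = λ { r x (s , x≃s) →
        r * s , ≋⇒≃ (≋-trans (*F-congˡ (ι r) (mk≋ {x} {ι s} x≃s)) (≋-sym (ι-* r s))) }
    }

  Rᵖ-*F-closed : ∀ {a b} → Rᵖ a → Rᵖ b → Rᵖ (a *F b)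
  Rᵖ-*F-closed {a} {b} (r , a≃r) (s , b≃s) =
    r * s , ≋⇒≃ (≋-trans (*F-cong (mk≋ {a} {ι r} a≃r) (mk≋ {b} {ι s} b≃s)) (≋-sym (ι-* r s)))

  ⊗-intro : ∀ {I J a b} → I a → J b → (I ⊗ J) (a *F b)
  ⊗-intro {a = a} {b} Ia Jb = ps {y = 0F} (pz (≋⇒≃ (≋-refl {0F}))) Ia Jb (≋⇒≃ (≋-sym (+F-identityˡ (a *F b))))

  ⊗-resp-≋ : ∀ {I J x y} → x ≋ y → (I ⊗ J) x → (I ⊗ J) y
  ⊗-resp-≋ {x = x} x≋y (pz x≃0) = pz (≋⇒≃ (≋-trans (≋-sym x≋y) (mk≋ {x} {0F} x≃0)))
  ⊗-resp-≋ {x = x} x≋y (ps {y = z} {a} {b} IJz Ia Jb x≃z+ab) =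
    ps IJz Ia Jb (≋⇒≃ (≋-trans (≋-sym x≋y) (mk≋ {x} {z +F (a *F b)} x≃z+ab)))

  ⊗-+F-closed : ∀ {I J x y} → (I ⊗ J) x → (I ⊗ J) y → (I ⊗ J) (x +F y)
  ⊗-+F-closed {x = x} {y} IJx (pz y≃0) =
    ⊗-resp-≋ (≋-trans (≋-sym (+F-identityʳ x)) (+F-congˡ x (≋-sym (mk≋ {y} {0F} y≃0)))) IJx
  ⊗-+F-closed {x = x} {y} IJx (ps {y = z} {a} {b} IJz Ia Jb y≃z+ab) =
    ps (⊗-+F-closed IJx IJz) Ia Jb
       (≋⇒≃ (≋-trans (+F-congˡ x (mk≋ {y} {z +F (a *F b)} y≃z+ab)) (≋-sym (+F-assoc x z (a *F b)))))

  ⊗-smul-closed : ∀ {I J} → IsSubmodule I → ∀ r {x} → (I ⊗ J) x → (I ⊗ J) (ι r *F x)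
  ⊗-smul-closed sI r {x} (pz x≃0) = pz (≋⇒≃ (≋-trans (*F-congˡ (ι r) (mk≋ {x} {0F} x≃0)) (*F-zeroʳ (ι r))))
  ⊗-smul-closed sI r {x} (ps {y = z} {a} {b} IJz Ia Jb x≃z+ab) =
    ps (⊗-smul-closed sI r IJz) (sm-smul sI r a Ia) Jb (≋⇒≃ (begin
      ι r *F x
        ≈⟨ *F-congˡ (ι r) (mk≋ {x} {z +F (a *F b)} x≃z+ab) ⟩
      ι r *F (z +F (a *F b))
        ≈⟨ solve 4 (λ r z a b → r :* (z :+ a :* b) := r :* z :+ r :* a :* b) ≋-refl (ι r) z a b ⟩
      (ι r *F z) +F ((ι r *F a) *F b) ∎))
    where open SetoidReasoning ≋-setoid

  ⊗-submodule : ∀ {I J} → IsSubmodule I → IsSubmodule (I ⊗ J)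
  ⊗-submodule sI = record
    { sm-resp = λ x y x≃y → ⊗-resp-≋ (mk≋ {x} {y} x≃y)
    ; sm-zero = pz (≋⇒≃ (≋-refl {0F}))
    ; sm-add = λ _ _ → ⊗-+F-closed
    ; sm-smul = λ r _ → ⊗-smul-closed sI r
    }

  ⊗-least : ∀ {I J M} → IsSubmodule M → (∀ {a b} → I a → J b → M (a *F b)) → (I ⊗ J) ⊆ M
  ⊗-least sM ab∈M x (pz x≃0) = ∈-resp-≋ sM (≋-sym (mk≋ {x} {0F} x≃0)) (sm-zero sM)
  ⊗-least sM ab∈M x (ps {y = z} {a} {b} IJz Ia Jb x≃z+ab) =
    ∈-resp-≋ sM (≋-sym (mk≋ {x} {z +F (a *F b)} x≃z+ab)) (sm-add sM _ _ (⊗-least sM ab∈M z IJz) (ab∈M Ia Jb))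

  ⊗-mono : ∀ {I I′ J J′} → I ⊆ I′ → J ⊆ J′ → (I ⊗ J) ⊆ (I′ ⊗ J′)
  ⊗-mono I⊆I′ J⊆J′ x (pz x≃0) = pz x≃0
  ⊗-mono I⊆I′ J⊆J′ x (ps IJz Ia Jb x≃z+ab) =
    ps (⊗-mono I⊆I′ J⊆J′ _ IJz) (I⊆I′ _ Ia) (J⊆J′ _ Jb) x≃z+ab

  ⊗-cong : ∀ {I I′ J J′} → I ≅ I′ → J ≅ J′ → (I ⊗ J) ≅ (I′ ⊗ J′)
  ⊗-cong (I⊆I′ , I′⊆I) (J⊆J′ , J′⊆J) = ⊗-mono I⊆I′ J⊆J′ , ⊗-mono I′⊆I J′⊆J

  ⊗-congˡ : ∀ {I J J′} → J ≅ J′ → (I ⊗ J) ≅ (I ⊗ J′)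
  ⊗-congˡ = ⊗-cong ≅-refl

  ⊗-congʳ : ∀ {I I′ J} → I ≅ I′ → (I ⊗ J) ≅ (I′ ⊗ J)
  ⊗-congʳ I≅I′ = ⊗-cong I≅I′ ≅-refl

  ⊗-comm-⊆ : ∀ {I J} → (I ⊗ J) ⊆ (J ⊗ I)
  ⊗-comm-⊆ x (pz x≃0) = pz x≃0
  ⊗-comm-⊆ x (ps {y = z} {a} {b} IJz Ia Jb x≃z+ab) =
    ps (⊗-comm-⊆ z IJz) Jb Ia (≋⇒≃ (≋-trans (mk≋ {x} {z +F (a *F b)} x≃z+ab) (+F-congˡ z (*F-comm a b))))

  ⊗-comm : ∀ {I J} → (I ⊗ J) ≅ (J ⊗ I)
  ⊗-comm = ⊗-comm-⊆ , ⊗-comm-⊆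

  ∶∶-submodule : ∀ {I J} → IsSubmodule I → IsSubmodule (I ∶∶ J)
  ∶∶-submodule sI = record
    { sm-resp = λ x y x≃y I∶∶Jx z Jz → ∈-resp-≋ sI (*F-congʳ z (mk≋ {x} {y} x≃y)) (I∶∶Jx z Jz)
    ; sm-zero = λ z _ → ∈-resp-≋ sI (≋-sym (*F-zeroˡ z)) (sm-zero sI)
    ; sm-add = λ x y I∶∶Jx I∶∶Jy z Jz →
        ∈-resp-≋ sI (≋-sym (*F-distribʳ-+F z x y)) (sm-add sI _ _ (I∶∶Jx z Jz) (I∶∶Jy z Jz))
    ; sm-smul = λ r x I∶∶Jx z Jz → ∈-resp-≋ sI (≋-sym (*F-assoc (ι r) x z)) (sm-smul sI r _ (I∶∶Jx z Jz))
    }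

  ⊗⊆⇒⊆∶∶ : ∀ {I J K} → (K ⊗ J) ⊆ I → K ⊆ (I ∶∶ J)
  ⊗⊆⇒⊆∶∶ KJ⊆I x Kx y Jy = KJ⊆I _ (⊗-intro Kx Jy)

  ⊆∶∶⇒⊗⊆ : ∀ {I J K} → IsSubmodule I → K ⊆ (I ∶∶ J) → (K ⊗ J) ⊆ I
  ⊆∶∶⇒⊗⊆ sI K⊆I∶∶J = ⊗-least sI λ {a} {b} Ka Jb → K⊆I∶∶J a Ka b Jb

  ⊗-assoc : ∀ {I J K} → IsSubmodule I → ((I ⊗ J) ⊗ K) ≅ (I ⊗ (J ⊗ K))
  ⊗-assoc {I} {J} {K} sI = left-to-right , right-to-left
    where
    left-to-right : ((I ⊗ J) ⊗ K) ⊆ (I ⊗ (J ⊗ K))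
    left-to-right = ⊆∶∶⇒⊗⊆ (⊗-submodule sI) (⊗-least (∶∶-submodule (⊗-submodule sI))
      λ {a} {b} Ia Jb c Kc → ⊗-resp-≋ (≋-sym (*F-assoc a b c)) (⊗-intro Ia (⊗-intro Jb Kc)))
    s[IJ]K = ⊗-submodule {J = K} (⊗-submodule {J = J} sI)
    right-to-left : (I ⊗ (J ⊗ K)) ⊆ ((I ⊗ J) ⊗ K)
    right-to-left = ⊗-least s[IJ]K λ {a} {u} Ia JKu → ∈-resp-≋ s[IJ]K (*F-comm u a)
      (⊗-least (∶∶-submodule {J = I} s[IJ]K) (λ {b} {c} Jb Kc a Ia →
        ⊗-resp-≋ (≋-trans (*F-assoc a b c) (*F-comm a (b *F c))) (⊗-intro (⊗-intro Ia Jb) Kc)) u JKu a Ia)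

  ⊗-identityˡ : ∀ {I} → IsSubmodule I → (Rᵖ ⊗ I) ≅ I
  ⊗-identityˡ sI =
      ⊗-least sI (λ { {x} {a} (r , x≃r) Ia →
        ∈-resp-≋ sI (*F-congʳ a (≋-sym (mk≋ {x} {ι r} x≃r))) (sm-smul sI r a Ia) })
    , λ a Ia → ⊗-resp-≋ (*F-identityˡ a) (⊗-intro {a = ι 1#} (ι∈Rᵖ 1#) Ia)

  ⊗-identityʳ : ∀ {I} → IsSubmodule I → (I ⊗ Rᵖ) ≅ I
  ⊗-identityʳ sI = ≅-trans ⊗-comm (⊗-identityˡ sI)

  ⊗-interchange : ∀ {I J K L} → IsSubmodule I → IsSubmodule J → IsSubmodule K
                → ((I ⊗ J) ⊗ (K ⊗ L)) ≅ ((I ⊗ K) ⊗ (J ⊗ L))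
  ⊗-interchange {I} {J} {K} {L} sI sJ sK = begin-equality
    (I ⊗ J) ⊗ (K ⊗ L)  ≈⟨ ⊗-assoc sI ⟩
    I ⊗ (J ⊗ (K ⊗ L))  ≈⟨ ⊗-congˡ (⊗-assoc sJ) ⟨
    I ⊗ ((J ⊗ K) ⊗ L)  ≈⟨ ⊗-congˡ (⊗-congʳ ⊗-comm) ⟩
    I ⊗ ((K ⊗ J) ⊗ L)  ≈⟨ ⊗-congˡ (⊗-assoc sK) ⟩
    I ⊗ (K ⊗ (J ⊗ L))  ≈⟨ ⊗-assoc sI ⟨
    (I ⊗ K) ⊗ (J ⊗ L)  ∎
    where open ⊆-Reasoning

  ⊕-intro : ∀ {I J x a b} → I a → J b → x ≋ (a +F b) → (I ⊕ J) x
  ⊕-intro {a = a} {b} Ia Jb x≋a+b = a , b , Ia , Jb , ≋⇒≃ x≋a+b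

  ⊕-submodule : ∀ {I J} → IsSubmodule I → IsSubmodule J → IsSubmodule (I ⊕ J)
  ⊕-submodule sI sJ = record
    { sm-resp = λ { x y x≃y (a , b , Ia , Jb , x≃a+b) →
        ⊕-intro Ia Jb (≋-trans (≋-sym (mk≋ {x} {y} x≃y)) (mk≋ {x} {a +F b} x≃a+b)) }
    ; sm-zero = ⊕-intro (sm-zero sI) (sm-zero sJ) (≋-sym (+F-identityˡ 0F))
    ; sm-add = λ { x y (a , b , Ia , Jb , x≃a+b) (a′ , b′ , Ia′ , Jb′ , y≃a′+b′) →
        ⊕-intro (sm-add sI _ _ Ia Ia′) (sm-add sJ _ _ Jb Jb′) (begin
          x +F y
            ≈⟨ +F-cong (mk≋ {x} {a +F b} x≃a+b) (mk≋ {y} {a′ +F b′} y≃a′+b′) ⟩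
          (a +F b) +F (a′ +F b′)
            ≈⟨ solve 4 (λ a b a′ b′ → (a :+ b) :+ (a′ :+ b′) := (a :+ a′) :+ (b :+ b′)) ≋-refl a b a′ b′ ⟩
          (a +F a′) +F (b +F b′) ∎) }
    ; sm-smul = λ { r x (a , b , Ia , Jb , x≃a+b) → ⊕-intro (sm-smul sI r a Ia) (sm-smul sJ r b Jb)
        (≋-trans (*F-congˡ (ι r) (mk≋ {x} {a +F b} x≃a+b)) (*F-distribˡ-+F (ι r) a b)) }
    }
    where open SetoidReasoning ≋-setoid

  I⊆I⊕J : ∀ {I J} → IsSubmodule J → I ⊆ (I ⊕ J)
  I⊆I⊕J sJ a Ia = ⊕-intro Ia (sm-zero sJ) (≋-sym (+F-identityʳ a))

  J⊆I⊕J : ∀ {I J} → IsSubmodule I → J ⊆ (I ⊕ J)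
  J⊆I⊕J sI b Jb = ⊕-intro (sm-zero sI) Jb (≋-sym (+F-identityˡ b))

  ⊕-lub : ∀ {I J M} → IsSubmodule M → I ⊆ M → J ⊆ M → (I ⊕ J) ⊆ M
  ⊕-lub sM I⊆M J⊆M x (a , b , Ia , Jb , x≃a+b) =
    ∈-resp-≋ sM (≋-sym (mk≋ {x} {a +F b} x≃a+b)) (sm-add sM _ _ (I⊆M a Ia) (J⊆M b Jb))

  ⊕-mono : ∀ {I I′ J J′} → I ⊆ I′ → J ⊆ J′ → (I ⊕ J) ⊆ (I′ ⊕ J′)
  ⊕-mono I⊆I′ J⊆J′ x (a , b , Ia , Jb , x≃a+b) = a , b , I⊆I′ a Ia , J⊆J′ b Jb , x≃a+b

  ⊕-cong : ∀ {I I′ J J′} → I ≅ I′ → J ≅ J′ → (I ⊕ J) ≅ (I′ ⊕ J′)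
  ⊕-cong (I⊆I′ , I′⊆I) (J⊆J′ , J′⊆J) = ⊕-mono I⊆I′ J⊆J′ , ⊕-mono I′⊆I J′⊆J

  ⊗-distribˡ-⊕ : ∀ {I J K} → IsSubmodule I → IsSubmodule J → IsSubmodule K
               → (I ⊗ (J ⊕ K)) ≅ ((I ⊗ J) ⊕ (I ⊗ K))
  ⊗-distribˡ-⊕ sI sJ sK =
      ⊗-least (⊕-submodule (⊗-submodule sI) (⊗-submodule sI)) (λ { {a} {u} Ia (b , c , Jb , Kc , u≃b+c) →
        ⊕-intro (⊗-intro Ia Jb) (⊗-intro Ia Kc)
          (≋-trans (*F-congˡ a (mk≋ {u} {b +F c} u≃b+c)) (*F-distribˡ-+F a b c)) })
    , ⊕-lub (⊗-submodule sI) (⊗-mono ⊆-refl (I⊆I⊕J sK)) (⊗-mono ⊆-refl (J⊆I⊕J sJ))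

  ⊗-integral : ∀ {I J} → I ⊆ Rᵖ → J ⊆ Rᵖ → (I ⊗ J) ⊆ Rᵖ
  ⊗-integral I⊆R J⊆R = ⊗-least Rᵖ-submodule λ {a} {b} Ia Jb → Rᵖ-*F-closed {a} {b} (I⊆R a Ia) (J⊆R b Jb)

  ⊕-integral : ∀ {I J} → I ⊆ Rᵖ → J ⊆ Rᵖ → (I ⊕ J) ⊆ Rᵖ
  ⊕-integral = ⊕-lub Rᵖ-submodule

  ⊗-absorbʳ : ∀ {I K} → IsSubmodule I → K ⊆ Rᵖ → (I ⊗ K) ⊆ I
  ⊗-absorbʳ sI K⊆R = ⊆-trans (⊗-mono ⊆-refl K⊆R) (proj₁ (⊗-identityʳ sI))

  ⊗-absorbˡ : ∀ {I K} → IsSubmodule I → K ⊆ Rᵖ → (K ⊗ I) ⊆ I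
  ⊗-absorbˡ sI K⊆R = ⊆-trans (⊗-mono K⊆R ⊆-refl) (proj₁ (⊗-identityˡ sI))

  infixl 30 _⁻¹
  _⁻¹ : Sub → Sub
  J ⁻¹ = Rᵖ ∶∶ J

  ⁻¹-submodule : ∀ {J} → IsSubmodule (J ⁻¹)
  ⁻¹-submodule = ∶∶-submodule Rᵖ-submodule

  ⁻¹-cong : ∀ {I J} → I ≅ J → I ⁻¹ ≅ J ⁻¹
  ⁻¹-cong (I⊆J , J⊆I) = (λ x I⁻¹x y Jy → I⁻¹x y (J⊆I y Jy)) , (λ x J⁻¹x y Iy → J⁻¹x y (I⊆J y Iy))

  ⊗-inverseʳ : ∀ {J} → Invertible J → (J ⊗ J ⁻¹) ≅ Rᵖ
  ⊗-inverseʳ {J} (sJ , J′ , sJ′ , JJ′≅R) =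
      ⊆∶∶⇒⊗⊆ Rᵖ-submodule (λ x Jx y J⁻¹y → ∈-resp-≋ Rᵖ-submodule (*F-comm y x) (J⁻¹y x Jx))
    , ⊆-trans (proj₂ JJ′≅R) (⊗-mono ⊆-refl J′⊆J⁻¹)
    where
    J′⊆J⁻¹ : J′ ⊆ J ⁻¹
    J′⊆J⁻¹ = ⊗⊆⇒⊆∶∶ (⊆-trans (proj₁ ⊗-comm) (proj₁ JJ′≅R))

  ⊗-inverseˡ : ∀ {J} → Invertible J → (J ⁻¹ ⊗ J) ≅ Rᵖ
  ⊗-inverseˡ iJ = ≅-trans ⊗-comm (⊗-inverseʳ iJ)

  Rᵖ-invertible : Invertible Rᵖ
  Rᵖ-invertible = Rᵖ-submodule , Rᵖ , Rᵖ-submodule , ⊗-identityˡ Rᵖ-submodule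

  ⊗-invertible : ∀ {I J} → Invertible I → Invertible J → Invertible (I ⊗ J)
  ⊗-invertible (sI , I′ , sI′ , II′≅R) (sJ , J′ , sJ′ , JJ′≅R) =
    ⊗-submodule sI , I′ ⊗ J′ , ⊗-submodule sI′ ,
    ≅-trans (⊗-interchange sI sJ sI′) (≅-trans (⊗-cong II′≅R JJ′≅R) (⊗-identityˡ Rᵖ-submodule))

  ⁻¹-invertible : ∀ {J} → Invertible J → Invertible (J ⁻¹)
  ⁻¹-invertible iJ = ⁻¹-submodule , _ , proj₁ iJ , ⊗-inverseˡ iJ

  ≅-invertible : ∀ {I J} → I ≅ J → Invertible I → Invertible J
  ≅-invertible I≅J (sI , I′ , sI′ , II′≅R) =
    ≅-submodule I≅J sI , I′ , sI′ , ≅-trans (⊗-congʳ (≅-sym I≅J)) II′≅R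

  ⁻¹-unique : ∀ {I J} → Invertible I → IsSubmodule J → (I ⊗ J) ≅ Rᵖ → J ≅ I ⁻¹
  ⁻¹-unique {I} {J} iI sJ IJ≅R = begin-equality
    J                ≈⟨ ⊗-identityˡ sJ ⟨
    Rᵖ ⊗ J           ≈⟨ ⊗-congʳ (⊗-inverseˡ iI) ⟨
    (I ⁻¹ ⊗ I) ⊗ J   ≈⟨ ⊗-assoc ⁻¹-submodule ⟩
    I ⁻¹ ⊗ (I ⊗ J)   ≈⟨ ⊗-congˡ IJ≅R ⟩
    I ⁻¹ ⊗ Rᵖ        ≈⟨ ⊗-identityʳ ⁻¹-submodule ⟩
    I ⁻¹             ∎
    where open ⊆-Reasoning

  ⁻¹-distrib-⊗ : ∀ {I J} → Invertible I → Invertible J → (I ⊗ J) ⁻¹ ≅ (I ⁻¹ ⊗ J ⁻¹)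
  ⁻¹-distrib-⊗ iI iJ = ≅-sym (⁻¹-unique (⊗-invertible iI iJ) (⊗-submodule ⁻¹-submodule)
    (≅-trans (⊗-interchange (proj₁ iI) (proj₁ iJ) ⁻¹-submodule)
      (≅-trans (⊗-cong (⊗-inverseʳ iI) (⊗-inverseʳ iJ)) (⊗-identityˡ Rᵖ-submodule))))

  ⁻¹-involutive : ∀ {J} → Invertible J → J ⁻¹ ⁻¹ ≅ J
  ⁻¹-involutive iJ = ≅-sym (⁻¹-unique (⁻¹-invertible iJ) (proj₁ iJ) (⊗-inverseˡ iJ))

  Rᵖ⁻¹≅Rᵖ : Rᵖ ⁻¹ ≅ Rᵖ
  Rᵖ⁻¹≅Rᵖ = ≅-sym (⁻¹-unique Rᵖ-invertible Rᵖ-submodule (⊗-identityˡ Rᵖ-submodule))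

  ⊗-cancelʳ-⊆ : ∀ {I J K} → Invertible K → IsSubmodule I → IsSubmodule J → (I ⊗ K) ⊆ (J ⊗ K) → I ⊆ J
  ⊗-cancelʳ-⊆ {I} {J} {K} iK sI sJ IK⊆JK = begin
    I                 ≈⟨ ⊗-identityʳ sI ⟨
    I ⊗ Rᵖ            ≈⟨ ⊗-congˡ (⊗-inverseʳ iK) ⟨
    I ⊗ (K ⊗ K ⁻¹)    ≈⟨ ⊗-assoc sI ⟨
    (I ⊗ K) ⊗ K ⁻¹    ⊆⟨ ⊗-mono IK⊆JK ⊆-refl ⟩
    (J ⊗ K) ⊗ K ⁻¹    ≈⟨ ⊗-assoc sJ ⟩
    J ⊗ (K ⊗ K ⁻¹)    ≈⟨ ⊗-congˡ (⊗-inverseʳ iK) ⟩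
    J ⊗ Rᵖ            ≈⟨ ⊗-identityʳ sJ ⟩
    J                 ∎
    where open ⊆-Reasoning

  ⊗-cancelʳ : ∀ {I J K} → Invertible K → IsSubmodule I → IsSubmodule J → (I ⊗ K) ≅ (J ⊗ K) → I ≅ J
  ⊗-cancelʳ iK sI sJ (IK⊆JK , JK⊆IK) = ⊗-cancelʳ-⊆ iK sI sJ IK⊆JK , ⊗-cancelʳ-⊆ iK sJ sI JK⊆IK

  ∶∶≅⊗⁻¹ : ∀ {I J} → Invertible J → IsSubmodule I → (I ∶∶ J) ≅ (I ⊗ J ⁻¹)
  ∶∶≅⊗⁻¹ {I} {J} iJ sI = I∶∶J⊆IJ⁻¹ , ⊗⊆⇒⊆∶∶ IJ⁻¹J⊆I
    where
    open ⊆-Reasoning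
    s[I∶∶J] = ∶∶-submodule {J = J} sI
    I∶∶J⊆IJ⁻¹ : (I ∶∶ J) ⊆ (I ⊗ J ⁻¹)
    I∶∶J⊆IJ⁻¹ = begin
      I ∶∶ J                 ≈⟨ ⊗-identityʳ s[I∶∶J] ⟨
      (I ∶∶ J) ⊗ Rᵖ          ≈⟨ ⊗-congˡ (⊗-inverseʳ iJ) ⟨
      (I ∶∶ J) ⊗ (J ⊗ J ⁻¹)  ≈⟨ ⊗-assoc s[I∶∶J] ⟨
      ((I ∶∶ J) ⊗ J) ⊗ J ⁻¹  ⊆⟨ ⊗-mono (⊆∶∶⇒⊗⊆ sI ⊆-refl) ⊆-refl ⟩
      I ⊗ J ⁻¹               ∎
    IJ⁻¹J⊆I : ((I ⊗ J ⁻¹) ⊗ J) ⊆ I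
    IJ⁻¹J⊆I = begin
      (I ⊗ J ⁻¹) ⊗ J   ≈⟨ ⊗-assoc sI ⟩
      I ⊗ (J ⁻¹ ⊗ J)   ≈⟨ ⊗-congˡ (⊗-inverseˡ iJ) ⟩
      I ⊗ Rᵖ           ≈⟨ ⊗-identityʳ sI ⟩
      I                ∎

  ∶∶⊗-cancel : ∀ {I J} → Invertible J → IsSubmodule I → ((I ∶∶ J) ⊗ J) ≅ I
  ∶∶⊗-cancel {I} {J} iJ sI = begin-equality
    (I ∶∶ J) ⊗ J      ≈⟨ ⊗-congʳ (∶∶≅⊗⁻¹ iJ sI) ⟩
    (I ⊗ J ⁻¹) ⊗ J    ≈⟨ ⊗-assoc sI ⟩
    I ⊗ (J ⁻¹ ⊗ J)    ≈⟨ ⊗-congˡ (⊗-inverseˡ iJ) ⟩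
    I ⊗ Rᵖ            ≈⟨ ⊗-identityʳ sI ⟩
    I                 ∎
    where open ⊆-Reasoning

  Coprime : Sub → Sub → Set
  Coprime I J = (I ⊕ J) ≅ Rᵖ

  [p⊕q][p⊕r]⊆p⊕qr : ∀ {p q r} → IsIdeal p → IsIdeal q → r ⊆ Rᵖ
                   → ((p ⊕ q) ⊗ (p ⊕ r)) ⊆ (p ⊕ (q ⊗ r))
  [p⊕q][p⊕r]⊆p⊕qr {p} {q} {r} (sp , p⊆R) (sq , q⊆R) r⊆R =
    ⊗-least (⊕-submodule sp (⊗-submodule {J = r} sq)) λ {x} {y} → expand {x} {y}
    where
    expand : ∀ {x y} → (p ⊕ q) x → (p ⊕ r) y → (p ⊕ (q ⊗ r)) (x *F y)
    expand {x} {y} (a , b , pa , qb , x≃a+b) (a′ , c , pa′ , rc , y≃a′+c) =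
      ⊕-intro (sm-add sp _ _ ay∈p ba′∈p) (⊗-intro qb rc) (begin
        x *F y                         ≈⟨ *F-congʳ y (mk≋ {x} {a +F b} x≃a+b) ⟩
        (a +F b) *F y                  ≈⟨ *F-distribʳ-+F y a b ⟩
        (a *F y) +F (b *F y)           ≈⟨ +F-congˡ (a *F y) (*F-congˡ b (mk≋ {y} {a′ +F c} y≃a′+c)) ⟩
        (a *F y) +F (b *F (a′ +F c))
          ≈⟨ solve 5 (λ a b a′ c y → a :* y :+ b :* (a′ :+ c) := (a :* y :+ b :* a′) :+ b :* c)
                     ≋-refl a b a′ c y ⟩
        ((a *F y) +F (b *F a′)) +F (b *F c) ∎)
      where
      open SetoidReasoning ≋-setoid
      ay∈p : p (a *F y)
      ay∈p = ⊗-absorbʳ sp (⊕-integral p⊆R r⊆R) _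
        (⊗-intro {b = y} pa (⊕-intro pa′ rc (mk≋ {y} {a′ +F c} y≃a′+c)))
      ba′∈p : p (b *F a′)
      ba′∈p = ⊗-absorbˡ sp q⊆R _ (⊗-intro qb pa′)

  coprime-⊗ : ∀ {p q r} → IsIdeal p → IsIdeal q → r ⊆ Rᵖ → Coprime p q → Coprime p r → Coprime p (q ⊗ r)
  coprime-⊗ {p} {q} {r} p-ideal@(_ , p⊆R) q-ideal@(_ , q⊆R) r⊆R (_ , R⊆p⊕q) (_ , R⊆p⊕r) =
      ⊕-integral p⊆R (⊗-integral q⊆R r⊆R)
    , (begin
      Rᵖ                  ≈⟨ ⊗-identityˡ Rᵖ-submodule ⟨
      Rᵖ ⊗ Rᵖ             ⊆⟨ ⊗-mono R⊆p⊕q R⊆p⊕r ⟩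
      (p ⊕ q) ⊗ (p ⊕ r)   ⊆⟨ [p⊕q][p⊕r]⊆p⊕qr p-ideal q-ideal r⊆R ⟩
      p ⊕ (q ⊗ r)         ∎)
    where open ⊆-Reasoning

  coprime⇒pI⊕J≅I⊕J : ∀ {p I J} → IsIdeal p → IsIdeal I → IsIdeal J → Coprime p J
                    → ((p ⊗ I) ⊕ J) ≅ (I ⊕ J)
  coprime⇒pI⊕J≅I⊕J {p} {I} {J} (sp , p⊆R) (sI , I⊆R) (sJ , J⊆R) (_ , R⊆p⊕J) =
      ⊕-mono (⊗-absorbˡ sI p⊆R) ⊆-refl
    , ⊕-lub (⊕-submodule (⊗-submodule sp) sJ) I⊆pI⊕J (J⊆I⊕J (⊗-submodule sp))
    where
    open ⊆-Reasoning
    I⊆pI⊕J : I ⊆ ((p ⊗ I) ⊕ J)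
    I⊆pI⊕J = begin
      I                    ≈⟨ ⊗-identityˡ sI ⟨
      Rᵖ ⊗ I               ⊆⟨ ⊗-mono R⊆p⊕J ⊆-refl ⟩
      (p ⊕ J) ⊗ I          ≈⟨ ⊗-comm ⟩
      I ⊗ (p ⊕ J)          ≈⟨ ⊗-distribˡ-⊕ sI sp sJ ⟩
      (I ⊗ p) ⊕ (I ⊗ J)    ⊆⟨ ⊕-mono (proj₁ ⊗-comm) (⊗-absorbˡ sJ I⊆R) ⟩
      (p ⊗ I) ⊕ J          ∎

  ∶∶-integral : ∀ {I J} → Invertible J → IsSubmodule I → I ⊆ J → (I ∶∶ J) ⊆ Rᵖ
  ∶∶-integral {I} {J} iJ sI I⊆J = begin
    I ∶∶ J       ≈⟨ ∶∶≅⊗⁻¹ iJ sI ⟩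
    I ⊗ J ⁻¹     ⊆⟨ ⊗-mono I⊆J ⊆-refl ⟩
    J ⊗ J ⁻¹     ≈⟨ ⊗-inverseʳ iJ ⟩
    Rᵖ           ∎
    where open ⊆-Reasoning

module Products (R : CommutativeRing 0ℓ 0ℓ) (O : IsOrder R) where

  open OrderTheory R O
  open Submodules R O

  ∏ : List Sub → Sub
  ∏ [] = Rᵖ
  ∏ (I ∷ L) = I ⊗ ∏ L

  module Generated (B : SubSet) (B-invertible : ∀ {J} → B J → Invertible J) where

    ∏-invertible : ∀ {L} → All B L → Invertible (∏ L)
    ∏-invertible [] = Rᵖ-invertible
    ∏-invertible (BI ∷ BL) = ⊗-invertible (B-invertible BI) (∏-invertible BL)

    ∏-submodule : ∀ {L} → All B L → IsSubmodule (∏ L)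
    ∏-submodule BL = proj₁ (∏-invertible BL)

    ∏-++ : ∀ {L M} → All B L → All B M → ∏ (L ++ M) ≅ (∏ L ⊗ ∏ M)
    ∏-++ [] BM = ≅-sym (⊗-identityˡ (∏-submodule BM))
    ∏-++ (BI ∷ BL) BM = ≅-trans (⊗-congˡ (∏-++ BL BM)) (≅-sym (⊗-assoc (proj₁ (B-invertible BI))))

    Gen-resp : ∀ {I J} → Gen B I → I ≅ J → Gen B J
    Gen-resp (gone I≅R) I≅J = gone (≅-trans (≅-sym I≅J) I≅R)
    Gen-resp (gpos g BJ I≅KJ) I≅J = gpos g BJ (≅-trans (≅-sym I≅J) I≅KJ)
    Gen-resp (gneg g BJ I≅KJ⁻¹) I≅J = gneg g BJ (≅-trans (≅-sym I≅J) I≅KJ⁻¹)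

    Gen⇒invertible : ∀ {I} → Gen B I → Invertible I
    Gen⇒invertible (gone I≅R) = ≅-invertible (≅-sym I≅R) Rᵖ-invertible
    Gen⇒invertible (gpos g BJ I≅KJ) =
      ≅-invertible (≅-sym I≅KJ) (⊗-invertible (Gen⇒invertible g) (B-invertible BJ))
    Gen⇒invertible (gneg g BJ I≅KJ⁻¹) =
      ≅-invertible (≅-sym I≅KJ⁻¹) (⊗-invertible (Gen⇒invertible g) (⁻¹-invertible (B-invertible BJ)))

    Gen-⊗ : ∀ {I J} → Gen B I → Gen B J → Gen B (I ⊗ J)
    Gen-⊗ gI (gone J≅R) =
      Gen-resp gI (≅-sym (≅-trans (⊗-congˡ J≅R) (⊗-identityʳ (proj₁ (Gen⇒invertible gI)))))
    Gen-⊗ gI (gpos g BJ J≅KJ′) =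
      gpos (Gen-⊗ gI g) BJ (≅-trans (⊗-congˡ J≅KJ′) (≅-sym (⊗-assoc (proj₁ (Gen⇒invertible gI)))))
    Gen-⊗ gI (gneg g BJ J≅KJ′⁻¹) =
      gneg (Gen-⊗ gI g) BJ (≅-trans (⊗-congˡ J≅KJ′⁻¹) (≅-sym (⊗-assoc (proj₁ (Gen⇒invertible gI)))))

    Gen-⁻¹ : ∀ {I} → Gen B I → Gen B (I ⁻¹)
    Gen-⁻¹ (gone I≅R) = gone (≅-trans (⁻¹-cong I≅R) Rᵖ⁻¹≅Rᵖ)
    Gen-⁻¹ (gpos g BJ I≅KJ) =
      gneg (Gen-⁻¹ g) BJ (≅-trans (⁻¹-cong I≅KJ) (⁻¹-distrib-⊗ (Gen⇒invertible g) (B-invertible BJ)))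
    Gen-⁻¹ (gneg g BJ I≅KJ⁻¹) = gpos (Gen-⁻¹ g) BJ (≅-trans (⁻¹-cong I≅KJ⁻¹)
      (≅-trans (⁻¹-distrib-⊗ (Gen⇒invertible g) (⁻¹-invertible iJ)) (⊗-congˡ (⁻¹-involutive iJ))))
      where iJ = B-invertible BJ

    Gen-∏ : ∀ {L} → All B L → Gen B (∏ L)
    Gen-∏ [] = gone ≅-refl
    Gen-∏ (BI ∷ BL) = gpos (Gen-∏ BL) BI ⊗-comm

  module CoprimeFamily (em : ExcludedMiddle 0ℓ) (B : SubSet)
    (B-proper : ∀ J → B J → Invertible J × (J ⊆ Rᵖ) × ¬ (Rᵖ ⊆ J))
    (B-coprime : ∀ I J → B I → B J → ¬ (I ≅ J) → Coprime I J) where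

    B-invertible : ∀ {J} → B J → Invertible J
    B-invertible {J} BJ = proj₁ (B-proper J BJ)

    open Generated B B-invertible public

    B-ideal : ∀ {J} → B J → IsIdeal J
    B-ideal {J} BJ = proj₁ (B-invertible BJ) , proj₁ (proj₂ (B-proper J BJ))

    ∏-ideal : ∀ {L} → All B L → IsIdeal (∏ L)
    ∏-ideal [] = Rᵖ-submodule , ⊆-refl
    ∏-ideal (BI ∷ BL) = ⊗-submodule (proj₁ (B-ideal BI)) , ⊗-integral (proj₂ (B-ideal BI)) (proj₂ (∏-ideal BL))

    IsProduct : Sub → Set₁
    IsProduct I = Σ (List Sub) λ L → All B L × (I ≅ ∏ L)

    product-resp : ∀ {I J} → IsProduct I → J ≅ I → IsProduct J
    product-resp (L , BL , I≅∏L) J≅I = L , BL , ≅-trans J≅I I≅∏L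

    product-⊗ : ∀ {I J} → IsProduct I → IsProduct J → IsProduct (I ⊗ J)
    product-⊗ (L , BL , I≅∏L) (M , BM , J≅∏M) =
      L ++ M , ++⁺ BL BM , ≅-trans (⊗-cong I≅∏L J≅∏M) (≅-sym (∏-++ BL BM))

    coprime-∏ : ∀ {p L} → B p → All B L → All (λ q → ¬ (p ≅ q)) L → Coprime p (∏ L)
    coprime-∏ Bp [] [] = ⊕-lub Rᵖ-submodule (proj₂ (B-ideal Bp)) ⊆-refl , J⊆I⊕J (proj₁ (B-ideal Bp))
    coprime-∏ Bp (Bq ∷ BL) (p≇q ∷ p≇L) =
      coprime-⊗ (B-ideal Bp) (B-ideal Bq) (proj₂ (∏-ideal BL)) (B-coprime _ _ Bp Bq p≇q) (coprime-∏ Bp BL p≇L)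

    ∏-extract : ∀ {p L} → B p → All B L → (p∈L : Any (p ≅_) L) → ∏ L ≅ (p ⊗ ∏ (L ─ p∈L))
    ∏-extract Bp (Bq ∷ BL) (here p≅q) = ⊗-congʳ (≅-sym p≅q)
    ∏-extract {p} {q ∷ L} Bp (Bq ∷ BL) (there p∈L) = begin-equality
      q ⊗ ∏ L              ≈⟨ ⊗-congˡ (∏-extract Bp BL p∈L) ⟩
      q ⊗ (p ⊗ ∏ L′)       ≈⟨ ⊗-assoc sq ⟨
      (q ⊗ p) ⊗ ∏ L′       ≈⟨ ⊗-congʳ ⊗-comm ⟩
      (p ⊗ q) ⊗ ∏ L′       ≈⟨ ⊗-assoc sp ⟩
      p ⊗ (q ⊗ ∏ L′)       ∎
      where
      open ⊆-Reasoning
      L′ = L ─ p∈L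
      sp = proj₁ (B-ideal Bp)
      sq = proj₁ (B-ideal Bq)

    ∏-⊆-cancel : ∀ {q L M} → B q → All B L → All B M → (q∈L : Any (q ≅_) L)
               → ∏ L ⊆ (q ⊗ ∏ M) → ∏ (L ─ q∈L) ⊆ ∏ M
    ∏-⊆-cancel {q} {L} {M} Bq BL BM q∈L ∏L⊆q∏M =
      ⊗-cancelʳ-⊆ (B-invertible Bq) (∏-submodule (─⁺ q∈L BL)) (∏-submodule BM) (begin
        ∏ (L ─ q∈L) ⊗ q   ≈⟨ ⊗-comm ⟩
        q ⊗ ∏ (L ─ q∈L)   ≈⟨ ∏-extract Bq BL q∈L ⟨
        ∏ L               ⊆⟨ ∏L⊆q∏M ⟩
        q ⊗ ∏ M           ≈⟨ ⊗-comm ⟩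
        ∏ M ⊗ q           ∎)
      where open ⊆-Reasoning

    ∏-⊆⇒∣ : ∀ {L M} → All B L → All B M → ∏ L ⊆ ∏ M
          → Σ (List Sub) λ N → All B N × (∏ L ≅ (∏ M ⊗ ∏ N))
    ∏-⊆⇒∣ {L} BL [] _ = L , BL , ≅-sym (⊗-identityˡ (∏-submodule BL))
    ∏-⊆⇒∣ {L} {q ∷ M} BL (Bq ∷ BM) ∏L⊆q∏M with any? (λ p → em {q ≅ p}) L
    ... | no q∉L = ⊥-elim (proj₂ (proj₂ (B-proper q Bq)) (begin
      Rᵖ        ⊆⟨ proj₂ (coprime-∏ Bq BL (¬Any⇒All¬ L q∉L)) ⟩
      q ⊕ ∏ L   ⊆⟨ ⊕-lub sq ⊆-refl (⊆-trans ∏L⊆q∏M (⊗-absorbʳ sq (proj₂ (∏-ideal BM)))) ⟩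
      q         ∎))
      where
      open ⊆-Reasoning
      sq = proj₁ (B-ideal Bq)
    ... | yes q∈L = extend (∏-⊆⇒∣ (─⁺ q∈L BL) BM (∏-⊆-cancel Bq BL BM q∈L ∏L⊆q∏M))
      where
      open ⊆-Reasoning
      extend : (Σ (List Sub) λ N → All B N × (∏ (L ─ q∈L) ≅ (∏ M ⊗ ∏ N)))
             → Σ (List Sub) λ N → All B N × (∏ L ≅ ((q ⊗ ∏ M) ⊗ ∏ N))
      extend (N , BN , ∏L′≅∏M∏N) = N , BN , (begin-equality
        ∏ L                  ≈⟨ ∏-extract Bq BL q∈L ⟩
        q ⊗ ∏ (L ─ q∈L)      ≈⟨ ⊗-congˡ ∏L′≅∏M∏N ⟩
        q ⊗ (∏ M ⊗ ∏ N)      ≈⟨ ⊗-assoc (proj₁ (B-ideal Bq)) ⟨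
        (q ⊗ ∏ M) ⊗ ∏ N      ∎)

    IsQuotient : Sub → Set₁
    IsQuotient I = Σ (List Sub) λ L → Σ (List Sub) λ M → All B L × All B M × ((I ⊗ ∏ M) ≅ ∏ L)

    integral-quotient⇒product : ∀ {I} → IsIdeal I → IsQuotient I → IsProduct I
    integral-quotient⇒product {I} (sI , I⊆R) (L , M , BL , BM , I∏M≅∏L) with ∏-⊆⇒∣ BL BM ∏L⊆∏M
      where
      open ⊆-Reasoning
      ∏L⊆∏M : ∏ L ⊆ ∏ M
      ∏L⊆∏M = begin
        ∏ L         ≈⟨ I∏M≅∏L ⟨
        I ⊗ ∏ M     ⊆⟨ ⊗-absorbˡ (∏-submodule BM) I⊆R ⟩
        ∏ M         ∎
    ... | N , BN , ∏L≅∏M∏N = N , BN ,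
      ⊗-cancelʳ (∏-invertible BM) sI (∏-submodule BN) (≅-trans I∏M≅∏L (≅-trans ∏L≅∏M∏N ⊗-comm))

    product-⊕ : ∀ {L M} → All B L → All B M → IsProduct (∏ L ⊕ ∏ M)
    product-⊕ [] BM = [] , [] , ⊕-integral ⊆-refl (proj₂ (∏-ideal BM)) , I⊆I⊕J (∏-submodule BM)
    product-⊕ {p ∷ L} {M} (Bp ∷ BL) BM with any? (λ q → em {p ≅ q}) M
    ... | no p∉M = product-resp (product-⊕ BL BM)
      (coprime⇒pI⊕J≅I⊕J (B-ideal Bp) (∏-ideal BL) (∏-ideal BM) (coprime-∏ Bp BM (¬Any⇒All¬ M p∉M)))
    ... | yes p∈M with product-⊕ BL (─⁺ p∈M BM)
    ...   | N , BN , ∏L⊕∏M′≅∏N = p ∷ N , Bp ∷ BN , (begin-equality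
      (p ⊗ ∏ L) ⊕ ∏ M                    ≈⟨ ⊕-cong ≅-refl (∏-extract Bp BM p∈M) ⟩
      (p ⊗ ∏ L) ⊕ (p ⊗ ∏ (M ─ p∈M))      ≈⟨ ⊗-distribˡ-⊕ sp (∏-submodule BL) (∏-submodule (─⁺ p∈M BM)) ⟨
      p ⊗ (∏ L ⊕ ∏ (M ─ p∈M))            ≈⟨ ⊗-congˡ ∏L⊕∏M′≅∏N ⟩
      p ⊗ ∏ N                            ∎)
      where
      open ⊆-Reasoning
      sp = proj₁ (B-ideal Bp)

    Gen⇒quotient : ∀ {I} → Gen B I → IsQuotient I
    Gen⇒quotient (gone I≅R) =
      [] , [] , [] , [] , ≅-trans (⊗-identityʳ (≅-submodule (≅-sym I≅R) Rᵖ-submodule)) I≅R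
    Gen⇒quotient {I} (gpos {K = K} {J} g BJ I≅KJ) with Gen⇒quotient g
    ... | L , M , BL , BM , K∏M≅∏L = J ∷ L , M , BJ ∷ BL , BM , (begin-equality
      I ⊗ ∏ M          ≈⟨ ⊗-congʳ I≅KJ ⟩
      (K ⊗ J) ⊗ ∏ M    ≈⟨ ⊗-congʳ ⊗-comm ⟩
      (J ⊗ K) ⊗ ∏ M    ≈⟨ ⊗-assoc (proj₁ (B-invertible BJ)) ⟩
      J ⊗ (K ⊗ ∏ M)    ≈⟨ ⊗-congˡ K∏M≅∏L ⟩
      J ⊗ ∏ L          ∎)
      where open ⊆-Reasoning
    Gen⇒quotient {I} (gneg {K = K} {J} g BJ I≅KJ⁻¹) with Gen⇒quotient g
    ... | L , M , BL , BM , K∏M≅∏L = L , J ∷ M , BL , BJ ∷ BM , (begin-equality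
      I ⊗ (J ⊗ ∏ M)             ≈⟨ ⊗-congʳ I≅KJ⁻¹ ⟩
      (K ⊗ J ⁻¹) ⊗ (J ⊗ ∏ M)    ≈⟨ ⊗-assoc sK ⟩
      K ⊗ (J ⁻¹ ⊗ (J ⊗ ∏ M))    ≈⟨ ⊗-congˡ (⊗-assoc ⁻¹-submodule) ⟨
      K ⊗ ((J ⁻¹ ⊗ J) ⊗ ∏ M)    ≈⟨ ⊗-congˡ (⊗-congʳ (⊗-inverseˡ (B-invertible BJ))) ⟩
      K ⊗ (Rᵖ ⊗ ∏ M)            ≈⟨ ⊗-congˡ (⊗-identityˡ (∏-submodule BM)) ⟩
      K ⊗ ∏ M                   ≈⟨ K∏M≅∏L ⟩
      ∏ L                       ∎)
      where
      open ⊆-Reasoning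
      sK = proj₁ (Gen⇒invertible g)

module Noetherianity (R : CommutativeRing 0ℓ 0ℓ) (O : IsOrder R) where

  open import Data.Integer using (ℤ) renaming (-_ to -ℤ_)
  open import Data.Vec using (Vec; map)
  open import Relation.Binary.PropositionalEquality as ≡ using (_≡_; cong; cong₂)
  import Relation.Unary as U

  open CommutativeRing R hiding (_-_)
  open IsOrder O
  open OrderTheory R O
  open Fractions R O
  open Submodules R O
  open IsSubmodule
  open Group (ℤⁿ-group rank) using (ε; _∙_)
  open import Algebra.Properties.Group (ℤⁿ-group rank) using (identityˡ-unique; inverseʳ-unique)
  open import Algebra.Properties.Ring ring using (-1*x≈-x)

  toVec-0# : toVec 0# ≡ ε
  toVec-0# = identityˡ-unique (toVec 0#) (toVec 0#)
    (≡.trans (≡.sym (toVec-+ 0# 0#)) (toVec-cong (+-identityˡ 0#)))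

  toVec-neg : ∀ x → toVec (- x) ≡ map -ℤ_ (toVec x)
  toVec-neg x = inverseʳ-unique (toVec x) (toVec (- x))
    (≡.trans (≡.sym (toVec-+ x (- x))) (≡.trans (toVec-cong (-‿inverseʳ x)) toVec-0#))

  Lattice : Sub → U.Pred (Vec ℤ rank) 0ℓ
  Lattice I v = Σ Carrier λ x → I (ι x) × toVec x ≡ v

  Lattice-subgroup : ∀ {I} → IsSubmodule I → IsSubgroup (ℤⁿ-group rank) (Lattice I)
  Lattice-subgroup {I} sI = record
    { ε∈ = 0# , sm-zero sI , toVec-0#
    ; ∙-closed = λ (x , Ix , x↦u) (y , Iy , y↦v) →
        x + y , ∈-resp-≋ sI (≋-sym (ι-+ x y)) (sm-add sI _ _ Ix Iy) , ≡.trans (toVec-+ x y) (cong₂ _∙_ x↦u y↦v)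
    ; ⁻¹-closed = λ (x , Ix , x↦u) →
        - x , ∈-resp-≋ sI (≋-trans (≋-sym (ι-* (- 1#) x)) (ι-cong (-1*x≈-x x))) (sm-smul sI (- 1#) _ Ix)
            , ≡.trans (toVec-neg x) (cong (map -ℤ_) x↦u)
    }

  Lattice-mono : ∀ {I J} → I ⊆ J → Lattice I U.⊆ Lattice J
  Lattice-mono I⊆J (x , Ix , x↦v) = x , I⊆J _ Ix , x↦v

  Lattice-reflects-⊆ : ∀ {I J} → IsSubmodule I → IsIdeal J → Lattice J U.⊆ Lattice I → J ⊆ I
  Lattice-reflects-⊆ {I} {J} sI (sJ , J⊆R) LJ⊆LI x Jx with J⊆R x Jx
  ... | r , x≃r with LJ⊆LI (r , ∈-resp-≋ sJ (mk≋ {x} {ι r} x≃r) Jx , ≡.refl)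
  ...   | s , Is , s↦r = ∈-resp-≋ sI (≋-trans (ι-cong s≈r) (≋-sym (mk≋ {x} {ι r} x≃r))) Is
    where
    s≈r : s ≈ r
    s≈r = trans (sym (from-to s)) (trans (reflexive (cong fromVec s↦r)) (from-to r))

  infix 4 _⊋_
  _⊋_ : Rel Sub 0ℓ
  J ⊋ I = IsIdeal J × (I ⊆ J) × ¬ (J ⊆ I)

  ⊋-wellFounded : ExcludedMiddle 0ℓ → WellFounded _⊋_
  ⊋-wellFounded em I = acc λ ((sJ , _) , _) → accessible sJ (ℤⁿ-noetherian em rank _)
    where
    accessible : ∀ {I} → IsSubmodule I → Acc (Supergroup (ℤⁿ-group rank)) (Lattice I) → Acc _⊋_ I
    accessible sI (acc larger) = acc λ (J-ideal@(sJ , _) , I⊆J , J⊈I) → accessible sJ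
      (larger (Lattice-subgroup sJ , Lattice-mono I⊆J , λ LJ⊆LI → J⊈I (Lattice-reflects-⊆ sI J-ideal LJ⊆LI)))

module Closures (R : CommutativeRing 0ℓ 0ℓ) (O : IsOrder R)
  (X : OrderTheory.SubSet R O) (X-ideal : ∀ I → X I → OrderTheory.IsIdeal R O I) where

  open OrderTheory R O
  open Submodules R O
  open Products R O

  closure-ideal : ∀ {I} → Closure X I → IsIdeal I
  closure-ideal (base XI) = X-ideal _ XI
  closure-ideal one = Rᵖ-submodule , ⊆-refl
  closure-ideal (add cI cJ) with closure-ideal cI | closure-ideal cJ
  ... | sI , I⊆R | sJ , J⊆R = ⊕-submodule sI sJ , ⊕-integral I⊆R J⊆R
  closure-ideal (mul cI cJ) with closure-ideal cI | closure-ideal cJ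
  ... | sI , I⊆R | _ , J⊆R = ⊗-submodule sI , ⊗-integral I⊆R J⊆R
  closure-ideal (div cI _ _ I∶∶J⊆R) = ∶∶-submodule (proj₁ (closure-ideal cI)) , I∶∶J⊆R
  closure-ideal (resp cI I≅J) with closure-ideal cI
  ... | sI , I⊆R = ≅-submodule I≅J sI , ⊆-trans (proj₂ I≅J) I⊆R

  module _ (em : ExcludedMiddle 0ℓ) (B : SubSet) (basis : IsCoprimeBasis X B) where

    open CoprimeFamily em B (proj₁ basis) (proj₁ (proj₂ basis))

    closure-product : ∀ {I} → Closure X I → IsProduct I
    closure-product (base XI) = integral-quotient⇒product (X-ideal _ XI) (Gen⇒quotient (proj₂ (proj₂ basis) _ XI))
    closure-product one = [] , [] , ≅-refl
    closure-product (add cI cJ) with closure-product cI | closure-product cJ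
    ... | L , BL , I≅∏L | M , BM , J≅∏M = product-resp (product-⊕ BL BM) (⊕-cong I≅∏L J≅∏M)
    closure-product (mul cI cJ) = product-⊗ (closure-product cI) (closure-product cJ)
    closure-product (div {I} {J} cI cJ iJ I∶∶J⊆R) with closure-product cI | closure-product cJ
    ... | L , BL , I≅∏L | M , BM , J≅∏M =
      integral-quotient⇒product (∶∶-submodule sI , I∶∶J⊆R) (L , M , BL , BM , (begin-equality
        (I ∶∶ J) ⊗ ∏ M   ≈⟨ ⊗-congˡ J≅∏M ⟨
        (I ∶∶ J) ⊗ J     ≈⟨ ∶∶⊗-cancel iJ sI ⟩
        I                ≈⟨ I≅∏L ⟩
        ∏ L              ∎))
      where
      open ⊆-Reasoning
      sI = proj₁ (closure-ideal cI)
    closure-product (resp cI I≅J) = product-resp (closure-product cI) (≅-sym I≅J)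

    closure-invertible : ∀ {I} → Closure X I → Invertible I
    closure-invertible cI with closure-product cI
    ... | L , BL , I≅∏L = ≅-invertible (≅-sym I≅∏L) (∏-invertible BL)

    closure-Gen : ∀ {I} → Closure X I → Gen B I
    closure-Gen cI with closure-product cI
    ... | L , BL , I≅∏L = Gen-resp (Gen-∏ BL) (≅-sym I≅∏L)

    twoAbove-≤B : TwoAbove X ≤B B
    twoAbove-≤B I (gone I≅R) = gone I≅R
    twoAbove-≤B I (gpos g (cJ , _) I≅KJ) = Gen-resp (Gen-⊗ (twoAbove-≤B _ g) (closure-Gen cJ)) (≅-sym I≅KJ)
    twoAbove-≤B I (gneg g (cJ , _) I≅KJ⁻¹) =
      Gen-resp (Gen-⊗ (twoAbove-≤B _ g) (Gen-⁻¹ (closure-Gen cJ))) (≅-sym I≅KJ⁻¹)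

  module _ (em : ExcludedMiddle (lsuc 0ℓ)) (invertible : ∀ I → Closure X I → Invertible I) where

    open Noetherianity R O using (_⊋_; ⊋-wellFounded)

    private
      em₀ : ExcludedMiddle 0ℓ
      em₀ = lower-em {ℓ′ = lsuc 0ℓ} em

    twoAbove-proper : ∀ I → TwoAbove X I → Invertible I × (I ⊆ Rᵖ) × ¬ (Rᵖ ⊆ I)
    twoAbove-proper I (cI , J₁ , J₂ , cJ₁ , cJ₂ , I⊆J₁ , I⊆J₂ , J₁≇J₂ , _) =
        invertible I cI , proj₂ (closure-ideal cI)
      , λ R⊆I → J₁≇J₂ (≅-trans (≅Rᵖ cJ₁ I⊆J₁ R⊆I) (≅-sym (≅Rᵖ cJ₂ I⊆J₂ R⊆I)))
      where
      ≅Rᵖ : ∀ {J} → Closure X J → I ⊆ J → Rᵖ ⊆ I → J ≅ Rᵖ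
      ≅Rᵖ cJ I⊆J R⊆I = proj₂ (closure-ideal cJ) , ⊆-trans R⊆I I⊆J

    twoAbove-classify : ∀ {I J} → TwoAbove X I → Closure X J → I ⊆ J → (J ≅ I) ⊎ (J ≅ Rᵖ)
    twoAbove-classify {I} {J} tI@(cI , J₁ , J₂ , _ , _ , _ , _ , _ , above) cJ I⊆J =
      classify (above J cJ I⊆J) (above I cI ⊆-refl) (above Rᵖ one (proj₂ (closure-ideal cI)))
      where
      I≇R : ¬ (I ≅ Rᵖ)
      I≇R I≅R = proj₂ (proj₂ (twoAbove-proper I tI)) (proj₂ I≅R)
      classify : (J ≅ J₁) ⊎ (J ≅ J₂) → (I ≅ J₁) ⊎ (I ≅ J₂) → (Rᵖ ≅ J₁) ⊎ (Rᵖ ≅ J₂)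
               → (J ≅ I) ⊎ (J ≅ Rᵖ)
      classify (inj₁ J≅J₁) (inj₁ I≅J₁) _ = inj₁ (≅-trans J≅J₁ (≅-sym I≅J₁))
      classify (inj₂ J≅J₂) (inj₂ I≅J₂) _ = inj₁ (≅-trans J≅J₂ (≅-sym I≅J₂))
      classify (inj₁ J≅J₁) (inj₂ _) (inj₁ R≅J₁) = inj₂ (≅-trans J≅J₁ (≅-sym R≅J₁))
      classify (inj₂ J≅J₂) (inj₁ _) (inj₂ R≅J₂) = inj₂ (≅-trans J≅J₂ (≅-sym R≅J₂))
      classify (inj₁ _) (inj₂ I≅J₂) (inj₂ R≅J₂) = ⊥-elim (I≇R (≅-trans I≅J₂ (≅-sym R≅J₂)))
      classify (inj₂ _) (inj₁ I≅J₁) (inj₁ R≅J₁) = ⊥-elim (I≇R (≅-trans I≅J₁ (≅-sym R≅J₁)))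

    twoAbove-coprime : ∀ I J → TwoAbove X I → TwoAbove X J → ¬ (I ≅ J) → Coprime I J
    twoAbove-coprime I J tI@(cI , _) tJ@(cJ , _) I≇J =
      [ (λ I⊕J≅I → ⊥-elim (I⊕J≇I I⊕J≅I)) , id ]′
        (twoAbove-classify tI (add cI cJ) (I⊆I⊕J (proj₁ (closure-ideal cJ))))
      where
      I⊕J≇I : ¬ ((I ⊕ J) ≅ I)
      I⊕J≇I I⊕J≅I = [ I≇J , (λ I≅R → proj₂ (proj₂ (twoAbove-proper I tI)) (proj₂ I≅R)) ]′
        (twoAbove-classify tJ cI (⊆-trans (J⊆I⊕J (proj₁ (closure-ideal cI))) (proj₁ I⊕J≅I)))

    Intermediate : Sub → Set₁
    Intermediate I = Σ Sub λ J → Closure X J × (I ⊆ J) × ¬ (J ⊆ I) × ¬ (Rᵖ ⊆ J)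

    twoAbove-intro : ∀ {I} → Closure X I → ¬ (Rᵖ ⊆ I) → ¬ Intermediate I → TwoAbove X I
    twoAbove-intro {I} cI R⊈I no-intermediate =
      cI , I , Rᵖ , cI , one , ⊆-refl , proj₂ (closure-ideal cI) , (λ I≅R → R⊈I (proj₂ I≅R)) , classify
      where
      classify : ∀ J → Closure X J → I ⊆ J → (J ≅ I) ⊎ (J ≅ Rᵖ)
      classify J cJ I⊆J with em₀ {J ⊆ I} | em₀ {Rᵖ ⊆ J}
      ... | yes J⊆I | _ = inj₁ (J⊆I , I⊆J)
      ... | no _ | yes R⊆J = inj₂ (proj₂ (closure-ideal cJ) , R⊆J)
      ... | no J⊈I | no R⊈J = ⊥-elim (no-intermediate (J , cJ , I⊆J , J⊈I , R⊈J))

    ∶∶-⊋ : ∀ {I J} → Closure X I → Closure X J → I ⊆ J → ¬ (Rᵖ ⊆ J) → (I ∶∶ J) ⊋ I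
    ∶∶-⊋ {I} {J} cI cJ I⊆J R⊈J =
      (∶∶-submodule sI , ∶∶-integral iJ sI I⊆J) , ⊗⊆⇒⊆∶∶ (⊗-absorbʳ sI J⊆R) ,
      λ I∶∶J⊆I → R⊈J (R⊆J I∶∶J⊆I)
      where
      open ⊆-Reasoning
      sI = proj₁ (closure-ideal cI)
      sJ = proj₁ (closure-ideal cJ)
      J⊆R = proj₂ (closure-ideal cJ)
      iJ = invertible J cJ
      R⊆J : (I ∶∶ J) ⊆ I → Rᵖ ⊆ J
      R⊆J I∶∶J⊆I = ⊗-cancelʳ-⊆ (invertible I cI) Rᵖ-submodule sJ (begin
        Rᵖ ⊗ I              ≈⟨ ⊗-identityˡ sI ⟩
        I                   ≈⟨ ∶∶⊗-cancel iJ sI ⟨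
        (I ∶∶ J) ⊗ J        ⊆⟨ ⊗-mono I∶∶J⊆I ⊆-refl ⟩
        I ⊗ J               ≈⟨ ⊗-comm ⟩
        J ⊗ I               ∎)

    open Generated (TwoAbove X) (λ {I} tI → proj₁ (twoAbove-proper I tI))

    closure-Gen-twoAbove : ∀ {I} → Acc _⊋_ I → Closure X I → Gen (TwoAbove X) I
    closure-Gen-twoAbove {I} (acc larger) cI with em₀ {Rᵖ ⊆ I} | em {Intermediate I}
    ... | yes R⊆I | _ = gone (proj₂ (closure-ideal cI) , R⊆I)
    ... | no R⊈I | no none =
      gpos (gone ≅-refl) (twoAbove-intro cI R⊈I none) (≅-sym (⊗-identityˡ (proj₁ (closure-ideal cI))))
    ... | no _ | yes (J , cJ , I⊆J , J⊈I , R⊈J) = Gen-resp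
      (Gen-⊗ (closure-Gen-twoAbove (larger I∶∶J⊋I) (div cI cJ iJ (proj₂ (proj₁ I∶∶J⊋I))))
             (closure-Gen-twoAbove (larger (closure-ideal cJ , I⊆J , J⊈I)) cJ))
      (∶∶⊗-cancel iJ (proj₁ (closure-ideal cI)))
      where
      iJ = invertible J cJ
      I∶∶J⊋I = ∶∶-⊋ cI cJ I⊆J R⊈J

    twoAbove-basis : IsCoprimeBasis X (TwoAbove X)
    twoAbove-basis = twoAbove-proper , twoAbove-coprime ,
      λ I XI → closure-Gen-twoAbove (⊋-wellFounded em₀ I) (base XI)

proposition4p67 : ExcludedMiddle (Level.suc (Level.suc 0ℓ))
    → (R : CommutativeRing 0ℓ 0ℓ) (O : IsOrder R)
    → let open OrderTheory R O in
      (X : SubSet) → (∀ I → X I → IsIdeal I × NonZero I)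
    → ((∀ I → Closure X I → Invertible I) ⇔ HasCoprimeBasis X)
      × (HasCoprimeBasis X → IsMinimalCoprimeBasis X (TwoAbove X))
proposition4p67 em R O X X-nonzero-ideal =
    mk⇔ (λ invertible → TwoAbove X , twoAbove-basis em₁ invertible)
        (λ (B , basis) I → closure-invertible em₀ B basis)
  , λ (B , basis) → twoAbove-basis em₁ (λ I → closure-invertible em₀ B basis) , twoAbove-≤B em₀
  where
  open OrderTheory R O
  open Closures R O X (λ I XI → proj₁ (X-nonzero-ideal I XI))
  em₁ : ExcludedMiddle (lsuc 0ℓ)
  em₁ = lower-em {ℓ′ = lsuc (lsuc 0ℓ)} em
  em₀ : ExcludedMiddle 0ℓ
  em₀ = lower-em {ℓ′ = lsuc (lsuc 0ℓ)} em
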